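{- For every polynomial-time computable function $f$ there exists an orthogonal predicative recursive TRS $\mathcal{R}_f$ that computes $f$.
   Context: A TRS computes a function $f$ if for some defined symbol $g$ the relation $[\![g]\!]$ coincides with (the graph of) $f$, inputs and outputs being represented as values (natural numbers in binary notation, built from a constant $\epsilon$ and unary constructors $\mathsf{S}_1,\mathsf{S}_2$); $[\![g]\!]$ consists of tuples $(v_1,\dots,v_n,w)$ of values such that $g(v_1,\dots,v_n)$ innermost-rewrites to the normal form $w$. Orthogonal: left-linear and non-overlapping. Signature split into defined symbols $\mathcal{D}$ and constructors; values are terms over constructors and variables; basic terms $g(v_1,\dots,v_n)$, $g\in\mathcal{D}$, $v_i$ values; constructor TRS: finite, left-hand sides basic. Safe mapping: safe positions per symbol, others normal, constructors all safe; notation $f(s_1..s_k;s_{k+1}..s_{k+l})$. Precedence $\succeq$ ($\succ,\sim$), admissible if $f\sim g$ implies both defined or both constructors. $\approx_s$: equality or $f\sim g$ of equal arity with arguments related under a permutation preserving safe/normal status. $G_\downarrow=\{g\mid f\succ g,f\in G\}$; $\mathrm{Fun}(s)$. $>_{sq}$: $s=f(\ldots)>_{sq}t$ iff (1) $s_i\geqslant_{sq}t$, $i$ normal if $f\in\mathcal{D}$; or (2) $f\in\mathcal{D}$, $t=g(t_1..t_p)$, $f\succ g$, $s>_{sq}t_j$ all $j$. $>_{pop}$: (1) $s_i\geqslant_{pop}t$; (2) $f\in\mathcal{D}$, $t=g(t_1..t_m;t_{m+1}..t_{m+n})$, $f\succ g$, $s>_{sq}t_j$ for normal $j$, $s>_{pop}t_j$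 for safe $j$, at most one safe $t_j\notin\mathcal{T}(\mathrm{Fun}(s)_\downarrow,\mathcal{V})$; (3) $f\in\mathcal{D}$, $f\sim g$, normal arguments strictly and safe arguments weakly decreasing in the multiset extension of $>_{pop}$ modulo $\approx_s$ (weak versions add $\approx_s$). Predicative recursive: constructor TRS with $l>_{pop}r$ for all rules, for some safe mapping and admissible precedence. -}

module Defs where

open import Data.Nat using (ℕ; zero; suc; _+_; _*_; _^_; _≤_)
open import Data.Fin using (Fin) renaming (zero to fzero; suc to fsuc)
open import Data.Bool using (Bool; true; false; if_then_else_)
open import Data.Maybe using (Maybe; just; nothing)
open import Data.Product using (Σ; ∃; _×_; _,_)
open import Data.Sum using (_⊎_)
open import Data.Empty using (⊥)
open import Data.Unit using (⊤)
open import Data.Vec as Vec using (Vec; lookup; _[_]≔_)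
open import Data.List as List using (List; []; _∷_; _++_; length)
open import Data.List.Relation.Unary.All using (All)
open import Data.List.Relation.Unary.Any using (Any)
open import Data.List.Membership.Propositional using (_∈_)
open import Data.List.Relation.Binary.Permutation.Propositional using (_↭_)
open import Data.List.Relation.Binary.Pointwise using (Pointwise)
open import Data.Fin.Permutation using (Permutation; _⟨$⟩ʳ_)
open import Relation.Nullary using (¬_)
open import Relation.Binary.PropositionalEquality using (_≡_; _≢_; subst; sym)
open import Relation.Binary.Construct.Closure.ReflexiveTransitive using (Star)

-- Digits 1 and 2, least significant digit first:
--   [] = 0,  d1 ∷ ds = 2·ds + 1,  d2 ∷ ds = 2·ds + 2.
-- This matches the values  ε = 0,  S₁(x) = 2x+1,  S₂(x) = 2x+2.

data Digit : Set where
  d1 d2 : Digit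

dsuc : List Digit → List Digit
dsuc []        = d1 ∷ []
dsuc (d1 ∷ ds) = d2 ∷ ds
dsuc (d2 ∷ ds) = d1 ∷ dsuc ds

digits : ℕ → List Digit
digits zero    = []
digits (suc n) = dsuc (digits n)

digitsValue : List Digit → ℕ
digitsValue []        = 0
digitsValue (d1 ∷ ds) = 1 + 2 * digitsValue ds
digitsValue (d2 ∷ ds) = 2 + 2 * digitsValue ds

-- Tape letters: Fin (4 + G); 0 = blank, 1 = digit 1, 2 = digit 2,
-- 3 = separator, the remaining G letters are auxiliary.

data Move : Set where
  left right stay : Move

Letter : ℕ → Set
Letter G = Fin (4 + G)

blank : ∀ {G} → Letter G
blank = fzero

record TM : Set where
  field
    Q : ℕ                      -- states are Fin (suc Q); the initial state is zero
    G : ℕ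
    δ : Fin (suc Q) → Letter G → Maybe (Fin (suc Q) × Letter G × Move)
                               -- nothing = halt

module _ (M : TM) where
  open TM M

  -- state, cells left of the head (nearest first), scanned cell, cells to the right
  record Config : Set where
    constructor conf
    field
      state : Fin (suc Q)
      lefts : List (Letter G)
      cur   : Letter G
      rights : List (Letter G)

  headOr : List (Letter G) → Letter G × List (Letter G)
  headOr []       = blank , []
  headOr (a ∷ as) = a , as

  move : Fin (suc Q) → List (Letter G) → Letter G → List (Letter G) → Move → Config
  move q ls a rs left with headOr ls
  ... | (b , ls') = conf q ls' b (a ∷ rs)
  move q ls a rs right with headOr rs
  ... | (b , rs') = conf q (a ∷ ls) b rs'
  move q ls a rs stay = conf q ls a rs

  next : Config → Maybe Config
  next (conf q ls a rs) with δ q a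
  ... | nothing = nothing
  ... | just (q' , b , m) = just (move q' ls b rs m)

  runFor : ℕ → Config → Maybe Config
  runFor t c with next c
  runFor t       c | nothing = just c
  runFor zero    c | just _  = nothing
  runFor (suc t) c | just c' = runFor t c'

  initial : List (Letter G) → Config
  initial w with headOr w
  ... | (a , rs) = conf fzero [] a rs

  digitLetter : Digit → Letter G
  digitLetter d1 = fsuc fzero
  digitLetter d2 = fsuc (fsuc fzero)

  sepLetter : Letter G
  sepLetter = fsuc (fsuc (fsuc fzero))

  encodeInput : ∀ {n} → Vec ℕ n → List (Letter G)
  encodeInput Vec.[] = []
  encodeInput (x Vec.∷ Vec.[]) = List.map digitLetter (digits x)
  encodeInput (x Vec.∷ xs@(_ Vec.∷ _)) =
    List.map digitLetter (digits x) ++ sepLetter ∷ encodeInput xs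

  readDigits : List (Letter G) → List Digit
  readDigits []       = []
  readDigits (a ∷ as) with Data.Fin.toℕ a
  ... | 1 = d1 ∷ readDigits as
  ... | 2 = d2 ∷ readDigits as
  ... | _ = []

  output : Config → ℕ
  output (conf _ _ a rs) = digitsValue (readDigits (a ∷ rs))

  ComputesInTime : ∀ {n} → (Vec ℕ n → ℕ) → (ℕ → ℕ) → Set
  ComputesInTime f T = ∀ xs → Σ Config λ c →
    (runFor (T (length (encodeInput xs))) (initial (encodeInput xs)) ≡ just c)
    × output c ≡ f xs

PolyTimeComputable : ∀ {n} → (Vec ℕ n → ℕ) → Set
PolyTimeComputable f =
  Σ TM λ M → Σ ℕ λ c → Σ ℕ λ k → ComputesInTime M f (λ m → c * (suc m) ^ k + c)

-- Signatures: finitely many defined symbols and constructors; the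
-- constructors always include ε (nullary), S₁, S₂ (unary).

record Sig : Set where
  field
    nD  : ℕ
    arD : Fin nD → ℕ
    nC  : ℕ
    arC : Fin nC → ℕ

module _ (Σ' : Sig) where
  open Sig Σ'

  data Con : Set where
    cε cS1 cS2 : Con
    cX : Fin nC → Con

  data Symb : Set where
    def : Fin nD → Symb
    con : Con → Symb

  arity : Symb → ℕ
  arity (def g)      = arD g
  arity (con cε)     = 0
  arity (con cS1)    = 1
  arity (con cS2)    = 1
  arity (con (cX c)) = arC c

  IsDefined : Symb → Set
  IsDefined (def _) = ⊤
  IsDefined (con _) = ⊥

  data Term : Set where
    var : ℕ → Term
    app : (f : Symb) → Vec Term (arity f) → Term

  Subst : Set
  Subst = ℕ → Term

  mutual
    _⟨_⟩ : Term → Subst → Term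
    var x    ⟨ σ ⟩ = σ x
    app f ts ⟨ σ ⟩ = app f (substs ts σ)

    substs : ∀ {k} → Vec Term k → Subst → Vec Term k
    substs Vec.[] σ = Vec.[]
    substs (t Vec.∷ ts) σ = (t ⟨ σ ⟩) Vec.∷ substs ts σ

  data _⊴_ (u : Term) : Term → Set where
    here  : u ⊴ u
    below : ∀ {f ts} (i : Fin (arity f)) → u ⊴ lookup ts i → u ⊴ app f ts

  data _⊲_ (u : Term) : Term → Set where
    below : ∀ {f ts} (i : Fin (arity f)) → u ⊴ lookup ts i → u ⊲ app f ts

  data NonVar : Term → Set where
    nonVar : ∀ {f ts} → NonVar (app f ts)

  data IsValue : Term → Set where
    varV : ∀ x → IsValue (var x)
    conV : ∀ {c ts} → (∀ i → IsValue (lookup ts i)) → IsValue (app (con c) ts)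

  data Basic : Term → Set where
    basic : ∀ g (ts : Vec Term (arD g)) → (∀ i → IsValue (lookup ts i)) → Basic (app (def g) ts)

  digitsTerm : List Digit → Term
  digitsTerm []        = app (con cε) Vec.[]
  digitsTerm (d1 ∷ ds) = app (con cS1) (digitsTerm ds Vec.∷ Vec.[])
  digitsTerm (d2 ∷ ds) = app (con cS2) (digitsTerm ds Vec.∷ Vec.[])

  ⌜_⌝ : ℕ → Term
  ⌜ n ⌝ = digitsTerm (digits n)

  record Rule : Set where
    constructor _⇒_
    field
      lhs rhs : Term
  open Rule public

  TRS : Set
  TRS = List Rule

  ConstructorTRS : TRS → Set
  ConstructorTRS R = ∀ ρ → ρ ∈ R →
    Basic (lhs ρ) × (∀ x → var x ⊴ rhs ρ → var x ⊴ lhs ρ)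

  module _ (R : TRS) where

    Redex : Term → Set
    Redex u = Σ Rule λ ρ → ρ ∈ R × Σ Subst λ σ → u ≡ lhs ρ ⟨ σ ⟩

    NormalForm : Term → Set
    NormalForm t = ∀ u → u ⊴ t → ¬ Redex u

    data _→ᵢ_ : Term → Term → Set where
      rootStep : ∀ {ρ} → ρ ∈ R → (σ : Subst) →
                 (∀ u → u ⊲ (lhs ρ ⟨ σ ⟩) → NormalForm u) →
                 (lhs ρ ⟨ σ ⟩) →ᵢ (rhs ρ ⟨ σ ⟩)
      argStep  : ∀ {f ts t'} (i : Fin (arity f)) → lookup ts i →ᵢ t' →
                 app f ts →ᵢ app f (ts [ i ]≔ t')

    _→ᵢ*_ : Term → Term → Set
    _→ᵢ*_ = Star _→ᵢ_

    Computes : ∀ {n} → (Vec ℕ n → ℕ) → Set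
    Computes {n} f = Σ (Fin nD) λ g → Σ (arD g ≡ n) λ e →
      ∀ (xs : Vec ℕ n) (w : Term) →
        let input = app (def g) (subst (Vec Term) (sym e) (Vec.map ⌜_⌝ xs)) in
        ((input →ᵢ* w × NormalForm w × IsValue w) → w ≡ ⌜ f xs ⌝)
        × (w ≡ ⌜ f xs ⌝ → (input →ᵢ* w × NormalForm w × IsValue w))

  mutual
    occ : ℕ → Term → ℕ
    occ x (var y) with x Data.Nat.≟ y
    ... | Relation.Nullary.yes _ = 1
    ... | Relation.Nullary.no _  = 0
    occ x (app f ts) = occs x ts

    occs : ∀ {k} → ℕ → Vec Term k → ℕ
    occs x Vec.[] = 0
    occs x (t Vec.∷ ts) = occ x t + occs x ts

  LeftLinear : TRS → Set
  LeftLinear R = ∀ ρ → ρ ∈ R → ∀ x → occ x (lhs ρ) ≤ 1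

  -- rule i overlaps rule j at a non-variable position of lhs j
  -- (excluding a rule with itself at the root); rules renamed apart
  Overlap : TRS → Set
  Overlap R = Σ (Fin (length R)) λ i → Σ (Fin (length R)) λ j → Σ Term λ u →
    u ⊴ lhs (List.lookup R j) × NonVar u
    × (i ≢ j ⊎ u ⊲ lhs (List.lookup R j))
    × Σ Subst λ σ → Σ Subst λ τ → lhs (List.lookup R i) ⟨ σ ⟩ ≡ u ⟨ τ ⟩

  Orthogonal : TRS → Set
  Orthogonal R = LeftLinear R × ¬ Overlap R

  record SafeMapping : Set where
    field
      safe : (f : Symb) → Fin (arity f) → Bool
      con-safe : ∀ c i → safe (con c) i ≡ true

  record Precedence : Set₁ where
    field
      _≽_ : Symb → Symb → Set
      ≽-refl : ∀ {f} → f ≽ f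
      ≽-trans : ∀ {f g h} → f ≽ g → g ≽ h → f ≽ h
    _≻_ : Symb → Symb → Set
    f ≻ g = f ≽ g × ¬ (g ≽ f)
    _∼_ : Symb → Symb → Set
    f ∼ g = f ≽ g × g ≽ f

  Admissible : Precedence → Set
  Admissible P = ∀ f g → f ∼ g → (IsDefined f × IsDefined g) ⊎ (¬ IsDefined f × ¬ IsDefined g)
    where open Precedence P

  module POP (SM : SafeMapping) (P : Precedence) where
    open SafeMapping SM
    open Precedence P

    argsAt : Bool → (f : Symb) → Vec Term (arity f) → List Term
    argsAt b f ts = List.mapMaybe pick (List.allFin (arity f))
      where
        pick : Fin (arity f) → Maybe Term
        pick i = if safe f i then (if b then just (lookup ts i) else nothing)
                             else (if b then nothing else just (lookup ts i))

    normalArgs safeArgs : (f : Symb) → Vec Term (arity f) → List Term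
    normalArgs = argsAt false
    safeArgs   = argsAt true

    data _≈ₛ_ : Term → Term → Set where
      ≈refl : ∀ {t} → t ≈ₛ t
      ≈perm : ∀ {f g ss ts} → f ∼ g → (π : Permutation (arity f) (arity g)) →
              (∀ i → safe f i ≡ safe g (π ⟨$⟩ʳ i)) →
              (∀ i → lookup ss i ≈ₛ lookup ts (π ⟨$⟩ʳ i)) →
              app f ss ≈ₛ app g ts

    data Occurs (h : Symb) : Term → Set where
      atRoot : ∀ {ts} → Occurs h (app h ts)
      inArg  : ∀ {f ts} (i : Fin (arity f)) → Occurs h (lookup ts i) → Occurs h (app f ts)

    FunBelow : Term → Symb → Set
    FunBelow s h = Σ Symb λ f → Occurs f s × f ≻ h

    data InT (F : Symb → Set) : Term → Set where
      varT : ∀ x → InT F (var x)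
      appT : ∀ {h ts} → F h → (∀ i → InT F (lookup ts i)) → InT F (app h ts)

    AtMostOne : ∀ {k} → (Fin k → Set) → Set
    AtMostOne P' = ∀ j j' → P' j → P' j' → j ≡ j'

    -- multiset extension modulo ≈ₛ (lists as multisets)
    MulGe : (Term → Term → Set) → List Term → List Term → Set
    MulGe _>_ M N = Σ (List Term) λ X → Σ (List Term) λ Y →
      Σ (List Term) λ Z → Σ (List Term) λ Z' →
      (M ↭ X ++ Z) × (N ↭ Y ++ Z') × Pointwise _≈ₛ_ Z Z'
      × All (λ y → Any (λ x → x > y) X) Y

    MulGt : (Term → Term → Set) → List Term → List Term → Set
    MulGt _>_ M N = Σ (List Term) λ X → Σ (List Term) λ Y →
      Σ (List Term) λ Z → Σ (List Term) λ Z' →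
      (M ↭ X ++ Z) × (N ↭ Y ++ Z') × Pointwise _≈ₛ_ Z Z'
      × X ≢ [] × All (λ y → Any (λ x → x > y) X) Y

    mutual
      data _>sq_ : Term → Term → Set where
        sq1 : ∀ {f ss t} (i : Fin (arity f)) → (IsDefined f → safe f i ≡ false) →
              lookup ss i ≥sq t → app f ss >sq t
        sq2 : ∀ {f ss g ts} → IsDefined f → f ≻ g →
              (∀ j → app f ss >sq lookup ts j) → app f ss >sq app g ts

      data _≥sq_ : Term → Term → Set where
        sq-gt : ∀ {s t} → s >sq t → s ≥sq t
        sq-eq : ∀ {s t} → s ≈ₛ t → s ≥sq t

    mutual
      data _>pop_ : Term → Term → Set where
        pop1 : ∀ {f ss t} (i : Fin (arity f)) → lookup ss i ≥pop t → app f ss >pop t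
        pop2 : ∀ {f ss g ts} → IsDefined f → f ≻ g →
               (∀ j → safe g j ≡ false → app f ss >sq lookup ts j) →
               (∀ j → safe g j ≡ true → app f ss >pop lookup ts j) →
               AtMostOne (λ j → safe g j ≡ true × ¬ InT (FunBelow (app f ss)) (lookup ts j)) →
               app f ss >pop app g ts
        pop3 : ∀ {f ss g ts} → IsDefined f → f ∼ g →
               MulGt _>pop_ (normalArgs f ss) (normalArgs g ts) →
               MulGe _>pop_ (safeArgs f ss) (safeArgs g ts) →
               app f ss >pop app g ts

      data _≥pop_ : Term → Term → Set where
        pop-gt : ∀ {s t} → s >pop t → s ≥pop t
        pop-eq : ∀ {s t} → s ≈ₛ t → s ≥pop t

  PredicativeRecursive : TRS → Set₁
  PredicativeRecursive R = ConstructorTRS R ×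
    Σ SafeMapping λ SM → Σ Precedence λ P → Admissible P ×
      (∀ ρ → ρ ∈ R → POP._>pop_ SM P (lhs ρ) (rhs ρ))

module Submission where

-- A machine M running in time c (m + 1)^k + c is simulated by innermost rewriting. Configurations are
-- constructor terms, and one rule per state, scanned letter and neighbouring cells performs a step. The clock
--   I_0(x, z, y) = step(y),   I_(j+1)(x, ε, y) = y,   I_(j+1)(x, az, y) = I_j(x, x, I_(j+1)(x, z, y))
-- makes I_(j+1)(x, z, y) perform |z| |x|^j steps by nested recursion on the normal arguments x and z while the
-- configuration y stays safe, so every rule decreases in the predicative path order once I_(j+1) is ranked above
-- I_j. The left-hand sides are linear and pairwise non-unifiable; in an orthogonal constructor TRS innermost steps
-- satisfy the diamond property, so the value reached by simulating M is the only normal form.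

open import Defs
open import Data.Bool using (Bool; true; false)
open import Data.Empty using (⊥; ⊥-elim)
open import Data.Fin as Fin using (Fin; toℕ; fromℕ; inject₁) renaming (suc to fsuc)
open import Data.Fin.Patterns
open import Data.Fin.Properties using (+↔⊎; *↔×; 1↔⊤; toℕ-fromℕ; toℕ-inject₁; cast-involutive)
open import Data.List as List using (List; []; _∷_; length; _++_)
open import Data.List.Properties using (length-tabulate; lookup-tabulate; length-replicate)
open import Data.List.Membership.Propositional using (_∈_)
open import Data.List.Membership.Propositional.Properties using (∈-lookup; ∈-tabulate⁺; ∈-tabulate⁻)
open import Data.List.Relation.Unary.All using ([]; _∷_)
open import Data.List.Relation.Unary.Any as Any using (here)
open import Data.List.Relation.Unary.Any.Properties using (lookup-index)
open import Data.List.Relation.Binary.Pointwise as Pointwise using ()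
open import Data.List.Relation.Binary.Permutation.Propositional using () renaming (refl to ↭-refl)
open import Data.List.Relation.Binary.Permutation.Propositional.Properties using (++-comm)
open import Data.Maybe as Maybe using (Maybe; just; nothing; _>>=_)
open import Data.Maybe.Properties using (just-injective)
open import Data.Nat as ℕ using (ℕ; zero; suc; _+_; _*_; _^_; _≤_; _<_; z≤n; s≤s)
open import Data.Nat.Properties
  using (≤-refl; ≤-trans; ≤-reflexive; <⇒≤; <⇒≱; <-irrefl; m<n⇒m<1+n; suc-injective; +-suc; +-identityʳ; +-comm;
         +-mono-≤; +-monoˡ-≤; +-monoʳ-≤; *-distribʳ-+; m≤m*n; m^n≢0)
open import Data.Product using (Σ; _×_; _,_; proj₁; proj₂)
open import Data.Product.Function.NonDependent.Propositional using (_×-↔_)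
open import Data.Sum as Sum using (_⊎_; inj₁; inj₂)
open import Data.Sum.Function.Propositional using (_⊎-↔_)
open import Data.Unit using (⊤; tt)
open import Data.Vec as Vec using (Vec; lookup; _[_]≔_) renaming ([] to []ᵥ; _∷_ to _∷ᵥ_)
open import Data.Vec.Properties using (lookup-map; lookup∘update; lookup∘update′; []≔-idempotent; []≔-commutes; []≔-lookup)
open import Function using (_∘_; case_of_)
open import Function.Bundles using (_↔_; mk↔ₛ′; Inverse; Injection)
open import Function.Properties.Inverse using (↔-refl; ↔-trans; ↔⇒↣)
open import Relation.Binary.Construct.Closure.ReflexiveTransitive using (ε; _◅_; _◅◅_; gmap)
open import Relation.Binary.PropositionalEquality
  using (_≡_; _≢_; refl; sym; trans; cong; cong₂; subst; subst₂; module ≡-Reasoning)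
open import Relation.Nullary using (¬_; yes; no)
open import Relation.Nullary.Decidable using (True; toWitness)

module Rewriting (S : Sig) where

  private
    Tm : Set
    Tm = Term S

    _⟪_⟫ : Tm → Subst S → Tm
    t ⟪ σ ⟫ = _⟨_⟩ S t σ

  lookup-substs : ∀ {k} (ts : Vec Tm k) σ i → lookup (substs S ts σ) i ≡ lookup ts i ⟪ σ ⟫
  lookup-substs (t ∷ᵥ ts) σ 0F       = refl
  lookup-substs (t ∷ᵥ ts) σ (fsuc i) = lookup-substs ts σ i

  app-injective : ∀ {f} {ts us : Vec Tm (arity S f)} → app f ts ≡ app f us → ts ≡ us
  app-injective refl = refl

  mutual
    substitution-cong : ∀ t σ τ → (∀ x → _⊴_ S (var x) t → σ x ≡ τ x) → t ⟪ σ ⟫ ≡ t ⟪ τ ⟫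
    substitution-cong (var x)    σ τ h = h x here
    substitution-cong (app f ts) σ τ h = cong (app f) (substitutions-cong ts σ τ (λ i x p → h x (below i p)))

    substitutions-cong : ∀ {k} (ts : Vec Tm k) σ τ → (∀ i x → _⊴_ S (var x) (lookup ts i) → σ x ≡ τ x) →
                  substs S ts σ ≡ substs S ts τ
    substitutions-cong []ᵥ        σ τ h = refl
    substitutions-cong (t ∷ᵥ ts) σ τ h = cong₂ _∷ᵥ_ (substitution-cong t σ τ (h 0F)) (substitutions-cong ts σ τ (h ∘ fsuc))

  substitution-determined : ∀ t σ τ → t ⟪ σ ⟫ ≡ t ⟪ τ ⟫ → ∀ x → _⊴_ S (var x) t → σ x ≡ τ x
  substitution-determined _          σ τ e x here        = e
  substitution-determined (app f ts) σ τ e x (below i p) = substitution-determined (lookup ts i) σ τ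
    (trans (sym (lookup-substs ts σ i)) (trans (cong (λ us → lookup us i) (app-injective e)) (lookup-substs ts τ i))) x p

  data Over (F : Symb S → Set) (P : Tm → Set) : Tm → Set where
    var : ∀ {x} → P (var x) → Over F P (var x)
    app : ∀ {f ts} → F f → (∀ i → Over F P (lookup ts i)) → Over F P (app f ts)

  Over-var : ∀ {F P t x} → Over F P t → _⊴_ S (var x) t → P (var x)
  Over-var (var p)    here        = p
  Over-var (app _ os) (below i q) = Over-var (os i) q

  Over-map : ∀ {F P Q t} → (∀ {x} → P (var x) → Q (var x)) → Over F P t → Over F Q t
  Over-map f (var p)    = var (f p)
  Over-map f (app g os) = app g (λ i → Over-map f (os i))

  ⊴-trans : ∀ {u v t} → _⊴_ S u v → _⊴_ S v t → _⊴_ S u t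
  ⊴-trans p here        = p
  ⊴-trans p (below i q) = below i (⊴-trans p q)

  ⊲⇒⊴ : ∀ {u t} → _⊲_ S u t → _⊴_ S u t
  ⊲⇒⊴ (below i p) = below i p

  mutual
    subterm-variables : ∀ {u} t → _⊴_ S t u → Over (λ _ → ⊤) (λ v → _⊴_ S v u) t
    subterm-variables (var x)    p = var p
    subterm-variables (app f ts) p = app tt (arguments-variables ts (λ i → ⊴-trans (below i here) p))

    arguments-variables : ∀ {u m} (ts : Vec Tm m) → (∀ i → _⊴_ S (lookup ts i) u) →
                          ∀ i → Over (λ _ → ⊤) (λ v → _⊴_ S v u) (lookup ts i)
    arguments-variables (t ∷ᵥ ts) ts⊴u 0F       = subterm-variables t (ts⊴u 0F)
    arguments-variables (t ∷ᵥ ts) ts⊴u (fsuc i) = arguments-variables ts (ts⊴u ∘ fsuc) i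

  IsConstructor : Symb S → Set
  IsConstructor f = ¬ IsDefined S f

  constructorTerm-value : ∀ {P t} → Over IsConstructor P t → IsValue S t
  constructorTerm-value (var {x} _)            = varV x
  constructorTerm-value (app {def _} notDef _) = ⊥-elim (notDef tt)
  constructorTerm-value (app {con _} _ os)     = conV (λ i → constructorTerm-value (os i))

  fromVec : ∀ {m} → Vec Tm m → Subst S
  fromVec []ᵥ        _       = var 0
  fromVec (t ∷ᵥ ts) zero    = t
  fromVec (t ∷ᵥ ts) (suc x) = fromVec ts x

  fromVec-lookup : ∀ {m} (ts : Vec Tm m) i → fromVec ts (toℕ i) ≡ lookup ts i
  fromVec-lookup (t ∷ᵥ ts) 0F       = refl
  fromVec-lookup (t ∷ᵥ ts) (fsuc i) = fromVec-lookup ts i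

  ⊴-split : ∀ {u t} → _⊴_ S u t → u ≡ t ⊎ _⊲_ S u t
  ⊴-split here        = inj₁ refl
  ⊴-split (below i p) = inj₂ (below i p)

  module _ (R : TRS S) where

    private
      infix 4 _⟶_ _⟶*_
      _⟶_ _⟶*_ : Tm → Tm → Set
      _⟶_  = _→ᵢ_ S R
      _⟶*_ = _→ᵢ*_ S R

    step-contains-redex : ∀ {t u} → t ⟶ u → Σ Tm λ v → _⊴_ S v t × Redex S R v
    step-contains-redex (rootStep {ρ} m σ _) = _ , here , ρ , m , σ , refl
    step-contains-redex (argStep i st) with step-contains-redex st
    ... | v , p , r = v , below i p , r

    normalForm-irreducible : ∀ {t u} → NormalForm S R t → ¬ (t ⟶ u)
    normalForm-irreducible nf st with step-contains-redex st
    ... | v , p , r = nf v p r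

    step-in-argument : ∀ {f} (ts : Vec Tm (arity S f)) i {s s'} → s ⟶ s' →
                       app f (ts [ i ]≔ s) ⟶ app f (ts [ i ]≔ s')
    step-in-argument {f} ts i {s} {s'} st =
      subst (λ us → app f (ts [ i ]≔ s) ⟶ app f us) ([]≔-idempotent ts i)
        (argStep i (subst (_⟶ s') (sym (lookup∘update i ts s)) st))

    steps-in-argument : ∀ {f} (ts : Vec Tm (arity S f)) i {s'} → lookup ts i ⟶* s' →
                        app f ts ⟶* app f (ts [ i ]≔ s')
    steps-in-argument {f} ts i {s'} ss =
      subst (λ us → app f us ⟶* app f (ts [ i ]≔ s')) ([]≔-lookup ts i)
        (gmap (λ s → app f (ts [ i ]≔ s)) (step-in-argument ts i) ss)

    module Constructor (constructorTRS : ConstructorTRS S R) where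

      data DefinedRoot : Tm → Set where
        definedRoot : ∀ g ts → DefinedRoot (app (def g) ts)

      basic-instance-definedRoot : ∀ {t} → Basic S t → ∀ σ → DefinedRoot (t ⟪ σ ⟫)
      basic-instance-definedRoot (basic g ts _) σ = definedRoot g _

      redex-definedRoot : ∀ {u} → Redex S R u → DefinedRoot u
      redex-definedRoot (ρ , m , σ , refl) = basic-instance-definedRoot (proj₁ (constructorTRS ρ m)) σ

      value-subterm : ∀ {t u} → IsValue S t → _⊴_ S u t → IsValue S u
      value-subterm v          here        = v
      value-subterm (conV vs) (below i p) = value-subterm (vs i) p

      value-definedRoot : ∀ {u} → IsValue S u → ¬ DefinedRoot u
      value-definedRoot (varV x) ()
      value-definedRoot (conV _) ()

      value-normal : ∀ {t} → IsValue S t → NormalForm S R t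
      value-normal v u p r = value-definedRoot (value-subterm v p) (redex-definedRoot r)

      valueArgs-subterms-normal : ∀ {f} {ts : Vec Tm (arity S f)} → (∀ i → IsValue S (lookup ts i)) →
                                  ∀ u → _⊲_ S u (app f ts) → NormalForm S R u
      valueArgs-subterms-normal vs u (below i p) = value-normal (value-subterm (vs i) p)

      rootStep-valueArgs : ∀ {ρ} → ρ ∈ R → ∀ σ {f ts u} → lhs ρ ⟪ σ ⟫ ≡ app f ts → (∀ i → IsValue S (lookup ts i)) →
                           rhs ρ ⟪ σ ⟫ ≡ u → app f ts ⟶ u
      rootStep-valueArgs {ρ} ρ∈R σ e vs refl =
        subst (_⟶ rhs ρ ⟪ σ ⟫) e
          (rootStep ρ∈R σ (subst (λ t → ∀ u → _⊲_ S u t → NormalForm S R u) (sym e) (valueArgs-subterms-normal vs)))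

      basic-proper-subterm-value : ∀ {t u} → Basic S t → _⊲_ S u t → IsValue S u
      basic-proper-subterm-value (basic g ts vs) (below i p) = value-subterm (vs i) p

      nonVar-value-instance : ∀ {u} → IsValue S u → NonVar S u → ∀ τ → ¬ DefinedRoot (u ⟪ τ ⟫)
      nonVar-value-instance (conV _) nonVar τ ()

      lhs-basic : ∀ i → Basic S (lhs (List.lookup R i))
      lhs-basic i = proj₁ (constructorTRS _ (∈-lookup i))

      -- In a constructor TRS proper subterms of left-hand sides are values, so rules can only overlap at the root.
      nonOverlapping : (∀ i j σ τ → lhs (List.lookup R i) ⟪ σ ⟫ ≡ lhs (List.lookup R j) ⟪ τ ⟫ → i ≡ j) →
                       ¬ Overlap S R
      nonOverlapping rootsDistinct (i , j , u , u⊴lhs , nv , i≢j⊎u⊲lhs , σ , τ , e) = go (⊴-split u⊴lhs) i≢j⊎u⊲lhs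
        where
          properSubterm-absurd : _⊲_ S u (lhs (List.lookup R j)) → ⊥
          properSubterm-absurd u⊲lhs = nonVar-value-instance (basic-proper-subterm-value (lhs-basic j) u⊲lhs) nv τ
            (subst DefinedRoot e (basic-instance-definedRoot (lhs-basic i) σ))
          go : u ≡ lhs (List.lookup R j) ⊎ _⊲_ S u (lhs (List.lookup R j)) → (i ≢ j ⊎ _⊲_ S u (lhs (List.lookup R j))) → ⊥
          go _           (inj₂ u⊲lhs) = properSubterm-absurd u⊲lhs
          go (inj₂ u⊲lhs) (inj₁ _)    = properSubterm-absurd u⊲lhs
          go (inj₁ refl)  (inj₁ i≢j)  = i≢j (rootsDistinct i j σ τ e)

    data StepView (t u : Tm) : Set where
      rootView : ∀ {ρ} → ρ ∈ R → ∀ σ → t ≡ lhs ρ ⟪ σ ⟫ → u ≡ rhs ρ ⟪ σ ⟫ →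
                 (∀ v → _⊲_ S v t → NormalForm S R v) → StepView t u
      argView  : ∀ f ts i {t'} → t ≡ app f ts → lookup ts i ⟶ t' → u ≡ app f (ts [ i ]≔ t') → StepView t u

    stepView : ∀ {t u} → t ⟶ u → StepView t u
    stepView (rootStep m σ nf) = rootView m σ refl refl nf
    stepView (argStep i st)    = argView _ _ i refl st refl

    module Confluence (constructorTRS : ConstructorTRS S R) (orthogonal : Orthogonal S R) where
      open Constructor constructorTRS

      rhs-determined : ∀ {ρ ρ'} → ρ ∈ R → ρ' ∈ R → ∀ σ σ' →
                       lhs ρ ⟪ σ ⟫ ≡ lhs ρ' ⟪ σ' ⟫ → rhs ρ ⟪ σ ⟫ ≡ rhs ρ' ⟪ σ' ⟫
      rhs-determined {ρ} {ρ'} m m' σ σ' e with Any.index m Fin.≟ Any.index m'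
      ... | no i≢j = ⊥-elim (proj₂ orthogonal (Any.index m , Any.index m' , _ , here ,
              basic-nonVar (lhs-basic (Any.index m')) , inj₁ i≢j , σ , σ' ,
              trans (cong (λ r → lhs r ⟪ σ ⟫) (sym (lookup-index m)))
                    (trans e (cong (λ r → lhs r ⟪ σ' ⟫) (lookup-index m')))))
        where
          basic-nonVar : ∀ {t} → Basic S t → NonVar S t
          basic-nonVar (basic _ _ _) = nonVar
      ... | yes i≡j with trans (lookup-index m) (trans (cong (List.lookup R) i≡j) (sym (lookup-index m')))
      ... | refl = substitution-cong (rhs ρ) σ σ'
                     (λ x p → substitution-determined (lhs ρ) σ σ' e x (proj₂ (constructorTRS ρ m) x p))

      Joinable : Tm → Tm → Set
      Joinable u v = u ≡ v ⊎ Σ Tm λ w → u ⟶ w × v ⟶ w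

      -- An innermost root step has normal arguments, so it never competes with a step below it; two root steps
      -- agree by orthogonality, and steps in different arguments commute.
      diamond : ∀ {t u v} → t ⟶ u → t ⟶ v → Joinable u v
      diamond (rootStep m σ nf) st₂ with stepView st₂
      ... | rootView m' σ' e refl _ = inj₁ (rhs-determined m m' σ σ' e)
      ... | argView f ts i e st refl =
              ⊥-elim (normalForm-irreducible (nf _ (subst (_⊲_ S (lookup ts i)) (sym e) (below i here))) st)
      diamond (argStep {f} {ts} i st) st₂ with stepView st₂
      ... | rootView _ _ _ refl nf' = ⊥-elim (normalForm-irreducible (nf' _ (below i here)) st)
      ... | argView .f .ts j refl st' refl with i Fin.≟ j
      ...   | yes refl with diamond st st'
      ...     | inj₁ refl = inj₁ refl
      ...     | inj₂ (w , a , b) = inj₂ (app f (ts [ i ]≔ w) , step-in-argument ts i a , step-in-argument ts i b)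
      diamond (argStep {f} {ts} i st) st₂ | argView .f .ts j refl st' refl | no i≢j =
        inj₂ (app f ((ts [ i ]≔ _) [ j ]≔ _) ,
              argStep j (subst (_⟶ _) (sym (lookup∘update′ (i≢j ∘ sym) ts _)) st') ,
              subst (λ us → _ ⟶ app f us) ([]≔-commutes ts j i (i≢j ∘ sym))
                (argStep i (subst (_⟶ _) (sym (lookup∘update′ i≢j ts _)) st)))

      steps-to-normalForm : ∀ {t u w} → t ⟶ u → t ⟶* w → NormalForm S R w → u ⟶* w
      steps-to-normalForm st ε         nf = ⊥-elim (normalForm-irreducible nf st)
      steps-to-normalForm st (st₁ ◅ ss) nf with diamond st st₁
      ... | inj₁ refl = ss
      ... | inj₂ (w , a , b) = a ◅ steps-to-normalForm b ss nf

      normalForm-unique : ∀ {t w w'} → t ⟶* w → NormalForm S R w → t ⟶* w' → NormalForm S R w' → w ≡ w'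
      normalForm-unique ε          nf ε          nf' = refl
      normalForm-unique ε          nf (st ◅ ss)  nf' = ⊥-elim (normalForm-irreducible nf st)
      normalForm-unique (st ◅ ss)  nf ss'        nf' = normalForm-unique ss nf (steps-to-normalForm st ss' nf') nf'


module RankPrecedence (S : Sig) (height : Fin (Sig.nD S) → ℕ) (SM : SafeMapping S) where
  open Rewriting S using (Over; var; app; IsConstructor)

  private
    Tm : Set
    Tm = Term S

  rank : Symb S → ℕ
  rank (def g) = suc (height g)
  rank (con _) = 0

  precedence : Precedence S
  precedence = record
    { _≽_     = λ f g → rank g ≤ rank f
    ; ≽-refl  = ≤-refl
    ; ≽-trans = λ f≽g g≽h → ≤-trans g≽h f≽g
    }

  open Precedence precedence

  ≻-rank : ∀ {f g} → rank g < rank f → f ≻ g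
  ≻-rank g<f = <⇒≤ g<f , <⇒≱ g<f

  def≻con : ∀ g κ → def g ≻ con κ
  def≻con g κ = ≻-rank {def g} {con κ} (s≤s z≤n)

  admissible : Admissible S precedence
  admissible (def _) (def _) _       = inj₁ (tt , tt)
  admissible (con _) (con _) _       = inj₂ ((λ ()) , (λ ()))
  admissible (def g) (con κ) (_ , p) = ⊥-elim (proj₂ (def≻con g κ) p)
  admissible (con κ) (def g) (p , _) = ⊥-elim (proj₂ (def≻con g κ) p)

  open POP S SM precedence

  ⊴⇒≥pop : ∀ {u v} → _⊴_ S v u → u ≥pop v
  ⊴⇒≥pop here        = pop-eq ≈refl
  ⊴⇒≥pop (below i p) = pop-gt (pop1 i (⊴⇒≥pop p))

  ⊲⇒>pop : ∀ {u v} → _⊲_ S v u → u >pop v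
  ⊲⇒>pop (below i p) = pop1 i (⊴⇒≥pop p)

  ⊴⇒>pop-argument : ∀ {f ss v} i → _⊴_ S v (lookup ss i) → app f ss >pop v
  ⊴⇒>pop-argument i p = pop1 i (⊴⇒≥pop p)

  >pop-argument : ∀ {f ss} i → app f ss >pop lookup ss i
  >pop-argument i = ⊴⇒>pop-argument i here

  >pop-recursion : ∀ {g ss ts} Z {s t} → s >pop t →
                  normalArgs (def g) ss ≡ Z ++ s ∷ [] → normalArgs (def g) ts ≡ Z ++ t ∷ [] →
                  safeArgs (def g) ss ≡ safeArgs (def g) ts → app (def g) ss >pop app (def g) ts
  >pop-recursion {g} {ss} {ts} Z {s} {t} s>t normal-ss normal-ts safe≡ = pop3 tt (≽-refl , ≽-refl)
    (subst₂ (MulGt _>pop_) (sym normal-ss) (sym normal-ts)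
      (s ∷ [] , t ∷ [] , Z , Z , ++-comm Z (s ∷ []) , ++-comm Z (t ∷ []) , Pointwise.refl ≈refl , (λ ()) , here s>t ∷ []))
    (subst (MulGe _>pop_ (safeArgs (def g) ss)) safe≡
      ([] , [] , safeArgs (def g) ss , safeArgs (def g) ss , ↭-refl , ↭-refl , Pointwise.refl ≈refl , []))

  value-⊴⇒≥sq : ∀ {u v} → IsValue S u → _⊴_ S v u → u ≥sq v
  value-⊴⇒≥sq _         here        = sq-eq ≈refl
  value-⊴⇒≥sq (conV vs) (below i p) = sq-gt (sq1 i (λ ()) (value-⊴⇒≥sq (vs i) p))

  >sq-lowerRank : ∀ {g ss t} → Over (λ f → rank f < rank (def g)) (app (def g) ss >sq_) t →
                  app (def g) ss >sq t
  >sq-lowerRank (var p)      = p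
  >sq-lowerRank (app f<g os) = sq2 tt (≻-rank f<g) (λ j → >sq-lowerRank (os j))

  constructorTerm-inT : ∀ {g ss P t} → Over IsConstructor P t → InT (FunBelow (app (def g) ss)) t
  constructorTerm-inT (var _)                 = varT _
  constructorTerm-inT {g} (app {con κ} _ os)  = appT (def g , atRoot , def≻con g κ) (λ i → constructorTerm-inT (os i))
  constructorTerm-inT (app {def _} notDef _) = ⊥-elim (notDef tt)

  >pop-constructorTerm : ∀ {g ss t} → Over IsConstructor (app (def g) ss >pop_) t →
                         app (def g) ss >pop t
  >pop-constructorTerm (var p) = p
  >pop-constructorTerm {g} (app {con κ} _ os) =
    pop2 tt (def≻con g κ) (λ j normal → case trans (sym normal) (SafeMapping.con-safe SM κ j) of λ ())
         (λ j _ → >pop-constructorTerm (os j))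
         (λ j _ (_ , notInT) _ → ⊥-elim (notInT (constructorTerm-inT (os j))))
  >pop-constructorTerm (app {def _} notDef _) = ⊥-elim (notDef tt)


record Finite (A : Set) : Set where
  field
    size        : ℕ
    enumeration : Fin size ↔ A

finite-Fin : ∀ m → Finite (Fin m)
finite-Fin m = record { size = m ; enumeration = ↔-refl }

finite-⊤ : Finite ⊤
finite-⊤ = record { size = 1 ; enumeration = 1↔⊤ }

finite-⊎ : ∀ {A B} → Finite A → Finite B → Finite (A ⊎ B)
finite-⊎ a b = record
  { size        = Finite.size a + Finite.size b
  ; enumeration = ↔-trans +↔⊎ (Finite.enumeration a ⊎-↔ Finite.enumeration b)
  }

finite-× : ∀ {A B} → Finite A → Finite B → Finite (A × B)
finite-× a b = record
  { size        = Finite.size a * Finite.size b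
  ; enumeration = ↔-trans *↔× (Finite.enumeration a ×-↔ Finite.enumeration b)
  }

finite-Maybe : ∀ {A} → Finite A → Finite (Maybe A)
finite-Maybe a = record
  { size        = suc (Finite.size a)
  ; enumeration = ↔-trans (Finite.enumeration (finite-⊎ finite-⊤ a)) ⊤⊎A↔Maybe
  }
  where
    ⊤⊎A↔Maybe = mk↔ₛ′ (Sum.[ (λ _ → nothing) , just ]) (Maybe.maybe inj₂ (inj₁ tt))
                      (λ { nothing → refl ; (just _) → refl }) (λ { (inj₁ tt) → refl ; (inj₂ _) → refl })

digits-double : ∀ v → digits (1 + 2 * v) ≡ d1 ∷ digits v × digits (2 + 2 * v) ≡ d2 ∷ digits v
digits-double zero = refl , refl
digits-double (suc v) rewrite +-suc v (v + 0) with digits-double v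
... | _ , even = cong dsuc even , cong (dsuc ∘ dsuc) even

digits-digitsValue : ∀ ds → digits (digitsValue ds) ≡ ds
digits-digitsValue []        = refl
digits-digitsValue (d1 ∷ ds) = trans (proj₁ (digits-double (digitsValue ds))) (cong (d1 ∷_) (digits-digitsValue ds))
digits-digitsValue (d2 ∷ ds) = trans (proj₂ (digits-double (digitsValue ds))) (cong (d2 ∷_) (digits-digitsValue ds))


module Simulation (n : ℕ) (M : TM) (c k : ℕ) where
  open TM M

  pattern mainSym      = 0F
  pattern startSym     = 1F
  pattern appendSym    = 2F
  pattern stepSym      = 3F
  pattern outputSym    = 4F
  pattern readSym      = 5F
  pattern iterateSym j = fsuc (fsuc (fsuc (fsuc (fsuc (fsuc j)))))

  defArity : Fin (6 + (2 + k)) → ℕ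
  defArity mainSym        = n
  defArity startSym       = 1
  defArity appendSym      = 2
  defArity stepSym        = 1
  defArity outputSym      = 1
  defArity readSym        = 1
  defArity (iterateSym _) = 3

  conArity : Fin (3 + G) → ℕ
  conArity 0F            = 3
  conArity (fsuc _) = 1

  S : Sig
  S = record { nD = 6 + (2 + k) ; arD = defArity ; nC = 3 + G ; arC = conArity }

  height : Fin (6 + (2 + k)) → ℕ
  height mainSym        = 4 + k
  height startSym       = 3 + k
  height appendSym      = 0
  height stepSym        = 0
  height outputSym      = 1
  height readSym        = 0
  height (iterateSym j) = 1 + toℕ j

  open Rewriting S

  Tm : Set
  Tm = Term S

  _⟪_⟫ : Tm → Subst S → Tm
  t ⟪ σ ⟫ = _⟨_⟩ S t σ

  Ltr : Set
  Ltr = Letter G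

  pattern auxLetter i = fsuc (fsuc (fsuc (fsuc i)))

  x₀ x₁ x₂ : Tm
  x₀ = var 0
  x₁ = var 1
  x₂ = var 2

  empty : Tm
  empty = app (con cε) []ᵥ

  -- Tape letters become unary constructors: digits are S₁ and S₂, the blank, the separator and the auxiliary
  -- letters are cX 1, cX 2, cX (3 + i); the ternary cX 0 builds configurations.
  letter : Ltr → Tm → Tm
  letter 0F            t = app (con (cX 1F)) (t ∷ᵥ []ᵥ)
  letter 1F            t = app (con cS1) (t ∷ᵥ []ᵥ)
  letter 2F            t = app (con cS2) (t ∷ᵥ []ᵥ)
  letter 3F            t = app (con (cX 2F)) (t ∷ᵥ []ᵥ)
  letter (auxLetter i) t = app (con (cX (fsuc (fsuc (fsuc i))))) (t ∷ᵥ []ᵥ)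

  wordOn : List Ltr → Tm → Tm
  wordOn []       t = t
  wordOn (a ∷ as) t = letter a (wordOn as t)

  word : List Ltr → Tm
  word as = wordOn as empty

  unary : ℕ → Tm
  unary m = word (List.replicate m 1F)

  config : Tm → Tm → Tm → Tm
  config q l r = app (con (cX 0F)) (q ∷ᵥ l ∷ᵥ r ∷ᵥ []ᵥ)

  configOn : Tm → Tm → Config M → Tm
  configOn tl tr (conf q ls a rs) = config (unary (toℕ q)) (wordOn ls tl) (letter a (wordOn rs tr))

  ⌜_⌝ᶜ : Config M → Tm
  ⌜ d ⌝ᶜ = configOn empty empty d

  mainT : Vec Tm n → Tm
  mainT = app (def mainSym)

  startT stepT outputT readT : Tm → Tm
  startT  t = app (def startSym) (t ∷ᵥ []ᵥ)
  stepT   t = app (def stepSym) (t ∷ᵥ []ᵥ)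
  outputT t = app (def outputSym) (t ∷ᵥ []ᵥ)
  readT   t = app (def readSym) (t ∷ᵥ []ᵥ)

  appendT : Tm → Tm → Tm
  appendT t u = app (def appendSym) (t ∷ᵥ u ∷ᵥ []ᵥ)

  iterateT : Fin (2 + k) → Tm → Tm → Tm → Tm
  iterateT j x z y = app (def (iterateSym j)) (x ∷ᵥ z ∷ᵥ y ∷ᵥ []ᵥ)

  variables : (m : ℕ) → ℕ → Vec Tm m
  variables zero    o = []ᵥ
  variables (suc m) o = var o ∷ᵥ variables m (suc o)

  inputTerm : ℕ → ℕ → Tm
  inputTerm zero                o = empty
  inputTerm (suc zero)          o = var o
  inputTerm (suc (suc m))       o = appendT (var o) (letter 3F (inputTerm (suc m) (suc o)))

  topLevel : Fin (2 + k)
  topLevel = fromℕ (suc k)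

  -- I_(k+1)(1x, 1^(2c), d) performs 2c (|x| + 1)^k ≥ c (|x| + 1)^k + c steps, covering the time bound of M.
  clock : Tm → Tm → Tm
  clock x d = iterateT topLevel (letter 1F x) (unary (c + c)) d

  clocked : Tm → Tm → Tm
  clocked x d = outputT (clock x d)

  rest : Maybe Ltr → Tm → Tm
  rest nothing  t = empty
  rest (just _) t = t

  stepConfig : Config M → Config M
  stepConfig d = Maybe.fromMaybe d (next M d)

  readLetter : Ltr → Tm
  readLetter 1F = letter 1F (readT x₀)
  readLetter 2F = letter 2F (readT x₀)
  readLetter _  = empty

  Key : Set
  Key = ⊤ ⊎ Maybe Ltr ⊎ Maybe Ltr ⊎ (Fin (suc Q) × Ltr × Maybe Ltr × Maybe Ltr)
          ⊎ ⊤ ⊎ (Fin (suc k) × Maybe Ltr) ⊎ ⊤ ⊎ Maybe Ltr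

  pattern kMain           = inj₁ tt
  pattern kStart h        = inj₂ (inj₁ h)
  pattern kAppend h       = inj₂ (inj₂ (inj₁ h))
  pattern kStep q a l r   = inj₂ (inj₂ (inj₂ (inj₁ (q , a , l , r))))
  pattern kIterateBase    = inj₂ (inj₂ (inj₂ (inj₂ (inj₁ tt))))
  pattern kIterate j h    = inj₂ (inj₂ (inj₂ (inj₂ (inj₂ (inj₁ (j , h))))))
  pattern kOutput         = inj₂ (inj₂ (inj₂ (inj₂ (inj₂ (inj₂ (inj₁ tt))))))
  pattern kRead h         = inj₂ (inj₂ (inj₂ (inj₂ (inj₂ (inj₂ (inj₂ h))))))

  finiteKey : Finite Key
  finiteKey = finite-⊎ finite-⊤ (finite-⊎ letterOrEnd (finite-⊎ letterOrEnd
    (finite-⊎ (finite-× (finite-Fin _) (finite-× (finite-Fin _) (finite-× letterOrEnd letterOrEnd)))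
    (finite-⊎ finite-⊤ (finite-⊎ (finite-× (finite-Fin _) letterOrEnd) (finite-⊎ finite-⊤ letterOrEnd))))))
    where letterOrEnd = finite-Maybe (finite-Fin _)

  rule : Key → Rule S
  rule kMain                 = mainT (variables n 0) ⇒ startT (inputTerm n 0)
  rule (kStart nothing)      = startT empty ⇒ clocked empty (config (unary 0) empty (letter 0F empty))
  rule (kStart (just a))     = startT (letter a x₀) ⇒ clocked (letter a x₀) (config (unary 0) empty (letter a x₀))
  rule (kAppend nothing)     = appendT empty x₁ ⇒ x₁
  rule (kAppend (just a))    = appendT (letter a x₀) x₁ ⇒ letter a (appendT x₀ x₁)
  -- l and r are the cells next to the head (nothing at an end of the tape); the rest of the tape is a variable.
  rule (kStep q a l r)       = stepT (configOn (rest l x₀) (rest r x₁) d) ⇒ configOn (rest l x₀) (rest r x₁) (stepConfig d)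
    where d = conf q (List.fromMaybe l) a (List.fromMaybe r)
  rule kIterateBase          = iterateT 0F x₀ x₁ x₂ ⇒ stepT x₂
  rule (kIterate j nothing)  = iterateT (fsuc j) x₀ empty x₂ ⇒ x₂
  rule (kIterate j (just a)) = iterateT (fsuc j) x₀ (letter a x₁) x₂ ⇒ iterateT (inject₁ j) x₀ x₀ (iterateT (fsuc j) x₀ x₁ x₂)
  rule kOutput               = outputT (config x₀ x₁ x₂) ⇒ readT x₂
  rule (kRead nothing)       = readT empty ⇒ empty
  rule (kRead (just a))      = readT (letter a x₀) ⇒ readLetter a

  open Finite finiteKey using (size; enumeration)

  keyAt : Fin size → Key
  keyAt = Inverse.to enumeration

  R : TRS S
  R = List.tabulate (rule ∘ keyAt)

  rule∈R : ∀ κ → rule κ ∈ R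
  rule∈R κ = subst (_∈ R) (cong rule (Inverse.strictlyInverseˡ enumeration κ))
                          (∈-tabulate⁺ {f = rule ∘ keyAt} (Inverse.from enumeration κ))

  ∈R⇒rule : ∀ {ρ} → ρ ∈ R → Σ Key λ κ → ρ ≡ rule κ
  ∈R⇒rule ρ∈R with ∈-tabulate⁻ ρ∈R
  ... | i , ρ≡ = keyAt i , ρ≡

  module _ {F : Symb S → Set} {P : Tm → Set} (con∈F : ∀ κ → F (con κ)) where

    empty-over : Over F P empty
    empty-over = app (con∈F cε) (λ ())

    letter-over : ∀ a {t} → Over F P t → Over F P (letter a t)
    letter-over 0F            o = app (con∈F _) (λ { 0F → o })
    letter-over 1F            o = app (con∈F _) (λ { 0F → o })
    letter-over 2F            o = app (con∈F _) (λ { 0F → o })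
    letter-over 3F            o = app (con∈F _) (λ { 0F → o })
    letter-over (auxLetter _) o = app (con∈F _) (λ { 0F → o })

    wordOn-over : ∀ as {t} → Over F P t → Over F P (wordOn as t)
    wordOn-over []       o = o
    wordOn-over (a ∷ as) o = letter-over a (wordOn-over as o)

    word-over : ∀ as → Over F P (word as)
    word-over as = wordOn-over as empty-over

    unary-over : ∀ m → Over F P (unary m)
    unary-over m = word-over (List.replicate m 1F)

    config-over : ∀ {q l r} → Over F P q → Over F P l → Over F P r → Over F P (config q l r)
    config-over oq ol or = app (con∈F _) (λ { 0F → oq ; 1F → ol ; 2F → or })

    clock-over : ∀ {x d} → F (def (iterateSym topLevel)) → Over F P x → Over F P d → Over F P (clock x d)
    clock-over iterate∈F ox od = app iterate∈F (λ { 0F → letter-over 1F ox ; 1F → unary-over (c + c) ; 2F → od })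

    configOn-over : ∀ d {tl tr} → Over F P tl → Over F P tr → Over F P (configOn tl tr d)
    configOn-over (conf q ls a rs) ol or = config-over (unary-over (toℕ q)) (wordOn-over ls ol) (letter-over a (wordOn-over rs or))

    rest-over : ∀ l {t} → Over F P t → Over F P (rest l t)
    rest-over nothing  _ = empty-over
    rest-over (just _) o = o

    inputTerm-over : ∀ m o → F (def appendSym) → (∀ i → P (lookup (variables m o) i)) → Over F P (inputTerm m o)
    inputTerm-over zero          o _        _ = empty-over
    inputTerm-over (suc zero)    o _        H = var (H 0F)
    inputTerm-over (suc (suc m)) o append∈F H =
      append-over (H 0F) (letter-over 3F (inputTerm-over (suc m) (suc o) append∈F (H ∘ fsuc)))
      where
        append-over : ∀ {x u} → P (var x) → Over F P u → Over F P (appendT (var x) u)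
        append-over p o = app append∈F (λ { 0F → var p ; 1F → o })

  letter-⊲ : ∀ a t → _⊲_ S t (letter a t)
  letter-⊲ 0F            t = below 0F here
  letter-⊲ 1F            t = below 0F here
  letter-⊲ 2F            t = below 0F here
  letter-⊲ 3F            t = below 0F here
  letter-⊲ (auxLetter _) t = below 0F here

  wordOn-⊴ : ∀ as t → _⊴_ S t (wordOn as t)
  wordOn-⊴ []       t = here
  wordOn-⊴ (a ∷ as) t = ⊴-trans (wordOn-⊴ as t) (⊲⇒⊴ (letter-⊲ a (wordOn as t)))

  con-isConstructor : ∀ κ → IsConstructor (con κ)
  con-isConstructor _ ()

  letterPattern-value : ∀ a x → IsValue S (letter a (var x))
  letterPattern-value a x = constructorTerm-value (letter-over {P = λ _ → ⊤} con-isConstructor a (var tt))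

  variables-value : ∀ m o i → IsValue S (lookup (variables m o) i)
  variables-value (suc m) o 0F       = varV o
  variables-value (suc m) o (fsuc i) = variables-value m (suc o) i

  lhs-basic : ∀ κ → Basic S (lhs (rule κ))
  lhs-basic kMain                 = basic mainSym _ (variables-value n 0)
  lhs-basic (kStart nothing)      = basic startSym _ (λ { 0F → conV (λ ()) })
  lhs-basic (kStart (just a))     = basic startSym _ (λ { 0F → letterPattern-value a 0 })
  lhs-basic (kAppend nothing)     = basic appendSym _ (λ { 0F → conV (λ ()) ; 1F → varV 1 })
  lhs-basic (kAppend (just a))    = basic appendSym _ (λ { 0F → letterPattern-value a 0 ; 1F → varV 1 })
  lhs-basic (kStep q a l r)       = basic stepSym _ (λ { 0F → constructorTerm-value
    (configOn-over {P = λ _ → ⊤} con-isConstructor (conf q (List.fromMaybe l) a (List.fromMaybe r))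
                   (rest-over con-isConstructor l (var tt)) (rest-over con-isConstructor r (var tt))) })
  lhs-basic kIterateBase          = basic (iterateSym 0F) _ (λ { 0F → varV 0 ; 1F → varV 1 ; 2F → varV 2 })
  lhs-basic (kIterate j nothing)  = basic (iterateSym (fsuc j)) _ (λ { 0F → varV 0 ; 1F → conV (λ ()) ; 2F → varV 2 })
  lhs-basic (kIterate j (just a)) = basic (iterateSym (fsuc j)) _ (λ { 0F → varV 0 ; 1F → letterPattern-value a 1 ; 2F → varV 2 })
  lhs-basic kOutput               = basic outputSym _ (λ { 0F → conV (λ { 0F → varV 0 ; 1F → varV 1 ; 2F → varV 2 }) })
  lhs-basic (kRead nothing)       = basic readSym _ (λ { 0F → conV (λ ()) })
  lhs-basic (kRead (just a))      = basic readSym _ (λ { 0F → letterPattern-value a 0 })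

  RhsVariables : Rule S → Set
  RhsVariables ρ = Over (λ _ → ⊤) (λ v → _⊴_ S v (lhs ρ)) (rhs ρ)

  rhs-variables : ∀ κ → RhsVariables (rule κ)
  rhs-variables kMain                 = app tt (λ { 0F → inputTerm-over _ n 0 tt (λ i → below i here) })
  rhs-variables (kStart nothing)      = app tt (λ { 0F → clock-over _ tt (empty-over _)
    (config-over _ (unary-over _ 0) (empty-over _) (letter-over _ 0F (empty-over _))) })
  rhs-variables (kStart (just a))     = app tt (λ { 0F → clock-over _ tt x₀-at (config-over _ (unary-over _ 0) (empty-over _) x₀-at) })
    where x₀-at = subterm-variables (letter a x₀) (below 0F here)
  rhs-variables (kAppend nothing)     = var (below 1F here)
  rhs-variables (kAppend (just a))    =
    letter-over _ a (app tt (λ { 0F → var (below 0F (⊲⇒⊴ (letter-⊲ a x₀))) ; 1F → var (below 1F here) }))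
  rhs-variables (kStep q a l r)       = configOn-over _ (stepConfig (conf q (List.fromMaybe l) a (List.fromMaybe r)))
    (subterm-variables (rest l x₀) (below 0F (below 1F (wordOn-⊴ (List.fromMaybe l) _))))
    (subterm-variables (rest r x₁) (below 0F (below 2F (⊴-trans (wordOn-⊴ (List.fromMaybe r) _) (⊲⇒⊴ (letter-⊲ a _))))))
  rhs-variables kIterateBase          = app tt (λ { 0F → var (below 2F here) })
  rhs-variables (kIterate j nothing)  = var (below 2F here)
  rhs-variables (kIterate j (just a)) = app tt (λ { 0F → var (below 0F here) ; 1F → var (below 0F here) ;
    2F → app tt (λ { 0F → var (below 0F here) ; 1F → var (below 1F (⊲⇒⊴ (letter-⊲ a x₁))) ; 2F → var (below 2F here) }) })
  rhs-variables kOutput               = app tt (λ { 0F → var (below 0F (below 2F here)) })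
  rhs-variables (kRead nothing)       = empty-over _
  rhs-variables (kRead (just a))      = readLetter-variables a
    where
      readLetter-variables : ∀ a → RhsVariables (rule (kRead (just a)))
      readLetter-variables 1F            = letter-over _ 1F (app tt (λ { 0F → var (below 0F (below 0F here)) }))
      readLetter-variables 2F            = letter-over _ 2F (app tt (λ { 0F → var (below 0F (below 0F here)) }))
      readLetter-variables 0F            = empty-over _
      readLetter-variables 3F            = empty-over _
      readLetter-variables (auxLetter _) = empty-over _

  constructorTRS : ConstructorTRS S R
  constructorTRS ρ ρ∈R with ∈R⇒rule ρ∈R
  ... | κ , refl = lhs-basic κ , λ x x⊴rhs → Over-var (rhs-variables κ) x⊴rhs

  safe : (f : Symb S) → Fin (arity S f) → Bool
  safe (con _)              _  = true
  safe (def mainSym)        _  = false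
  safe (def startSym)       _  = false
  safe (def appendSym)      0F = false
  safe (def appendSym)      1F = true
  safe (def stepSym)        _  = true
  safe (def outputSym)      _  = false
  safe (def readSym)        _  = false
  safe (def (iterateSym _)) 0F = false
  safe (def (iterateSym _)) 1F = false
  safe (def (iterateSym _)) 2F = true

  safeMapping : SafeMapping S
  safeMapping = record { safe = safe ; con-safe = λ _ _ → refl }

  open RankPrecedence S height safeMapping
  open POP S safeMapping precedence
  open Precedence precedence using (_≻_)

  letter->pop : ∀ {g ss t} a → app (def g) ss >pop t → app (def g) ss >pop letter a t
  letter->pop {g} 0F            p = pop2 tt (def≻con g (cX 1F)) (λ { 0F () }) (λ { 0F _ → p }) (λ { 0F 0F _ _ → refl })
  letter->pop {g} 1F            p = pop2 tt (def≻con g cS1) (λ { 0F () }) (λ { 0F _ → p }) (λ { 0F 0F _ _ → refl })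
  letter->pop {g} 2F            p = pop2 tt (def≻con g cS2) (λ { 0F () }) (λ { 0F _ → p }) (λ { 0F 0F _ _ → refl })
  letter->pop {g} 3F            p = pop2 tt (def≻con g (cX 2F)) (λ { 0F () }) (λ { 0F _ → p }) (λ { 0F 0F _ _ → refl })
  letter->pop {g} (auxLetter i) p = pop2 tt (def≻con g (cX (fsuc (fsuc (fsuc i))))) (λ { 0F () }) (λ { 0F _ → p }) (λ { 0F 0F _ _ → refl })


  iterate<start : rank (def (iterateSym topLevel)) < rank (def startSym)
  iterate<start rewrite toℕ-fromℕ k = ≤-refl

  iterate-descends : ∀ j → def (iterateSym (fsuc j)) ≻ def (iterateSym (inject₁ j))
  iterate-descends j =
    ≻-rank {def (iterateSym (fsuc j))} {def (iterateSym (inject₁ j))} (s≤s (s≤s (s≤s (≤-reflexive (toℕ-inject₁ j)))))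

  start>sq-clock : ∀ {t x d} → Over (λ f → rank f < rank (def startSym)) (startT t >sq_) x →
                   Over (λ f → rank f < rank (def startSym)) (startT t >sq_) d → startT t >sq clock x d
  start>sq-clock ox od = >sq-lowerRank (clock-over (λ _ → s≤s z≤n) iterate<start ox od)

  start>pop : ∀ {t x d} → startT t >sq clock x d → startT t >pop clocked x d
  start>pop sq = pop2 tt (≻-rank {def startSym} {def outputSym} (s≤s (s≤s (s≤s z≤n))))
                         (λ { 0F _ → sq }) (λ { 0F () }) (λ { 0F _ (() , _) _ })

  rule-decreasing : ∀ κ → lhs (rule κ) >pop rhs (rule κ)
  rule-decreasing kMain = pop2 tt (≻-rank {def mainSym} {def startSym} ≤-refl)
    (λ { 0F _ → >sq-lowerRank (inputTerm-over (λ _ → s≤s z≤n) n 0 (s≤s (s≤s z≤n)) (λ i → sq1 i (λ _ → refl) (sq-eq ≈refl))) })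
    (λ { 0F () }) (λ { 0F _ (() , _) _ })
  rule-decreasing (kStart nothing) = start>pop (start>sq-clock low (config-over low∈ (unary-over low∈ 0) low (letter-over low∈ 0F low)))
    where
      low∈ = λ _ → s≤s z≤n
      low = empty-over low∈
  rule-decreasing (kStart (just a)) = start>pop (start>sq-clock x (config-over low∈ (unary-over low∈ 0) (empty-over low∈) x))
    where
      low∈ = λ _ → s≤s z≤n
      x = letter-over low∈ a (var (sq1 0F (λ _ → refl) (value-⊴⇒≥sq (letterPattern-value a 0) (⊲⇒⊴ (letter-⊲ a x₀)))))
  rule-decreasing (kAppend nothing) = >pop-argument 1F
  rule-decreasing (kAppend (just a)) = letter->pop a (>pop-recursion [] (⊲⇒>pop (letter-⊲ a x₀)) refl refl refl)
  rule-decreasing (kStep q a l r) = >pop-constructorTerm (configOn-over con-isConstructor d′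
    (Over-map (λ p → ⊴⇒>pop-argument 0F (⊴-trans p (below 1F (wordOn-⊴ (List.fromMaybe l) _)))) (rest-variables l 0))
    (Over-map (λ p → ⊴⇒>pop-argument 0F (⊴-trans p (below 2F (⊴-trans (wordOn-⊴ (List.fromMaybe r) _) (⊲⇒⊴ (letter-⊲ a _))))))
      (rest-variables r 1)))
    where
      d′ = stepConfig (conf q (List.fromMaybe l) a (List.fromMaybe r))
      rest-variables : ∀ l x → Over IsConstructor (λ v → _⊴_ S v (rest l (var x))) (rest l (var x))
      rest-variables nothing  _ = empty-over con-isConstructor
      rest-variables (just _) _ = var here
  rule-decreasing kIterateBase = pop2 tt (≻-rank {def (iterateSym 0F)} {def stepSym} ≤-refl)
    (λ { 0F () }) (λ { 0F _ → >pop-argument 2F }) (λ { 0F 0F _ _ → refl })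
  rule-decreasing (kIterate j nothing) = >pop-argument 2F
  rule-decreasing (kIterate j (just a)) = pop2 tt (iterate-descends j)
    (λ { 0F _ → sq1 0F (λ _ → refl) (sq-eq ≈refl) ; 1F _ → sq1 0F (λ _ → refl) (sq-eq ≈refl) ; 2F () })
    (λ { 0F () ; 1F () ; 2F _ → >pop-recursion (x₀ ∷ []) (⊲⇒>pop (letter-⊲ a x₁)) refl refl refl })
    (λ { 2F 2F _ _ → refl ; 0F _ (() , _) _ ; 1F _ (() , _) _ ; 2F 0F _ (() , _) ; 2F 1F _ (() , _) })
  rule-decreasing kOutput = pop2 tt (≻-rank {def outputSym} {def readSym} ≤-refl)
    (λ { 0F _ → sq1 0F (λ _ → refl) (value-⊴⇒≥sq (conV (λ { 0F → varV 0 ; 1F → varV 1 ; 2F → varV 2 })) (below 2F here)) })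
    (λ { 0F () }) (λ { 0F _ (() , _) _ })
  rule-decreasing (kRead nothing) = >pop-constructorTerm (empty-over con-isConstructor)
  rule-decreasing (kRead (just a)) = read-decreasing a
    where
      read-digit : ∀ {a} → readT (letter a x₀) >pop readT x₀
      read-digit {a} = >pop-recursion [] (⊲⇒>pop (letter-⊲ a x₀)) refl refl refl
      read-decreasing : ∀ a → readT (letter a x₀) >pop readLetter a
      read-decreasing 1F            = letter->pop 1F (read-digit {1F})
      read-decreasing 2F            = letter->pop 2F (read-digit {2F})
      read-decreasing 0F            = >pop-constructorTerm (empty-over con-isConstructor)
      read-decreasing 3F            = >pop-constructorTerm (empty-over con-isConstructor)
      read-decreasing (auxLetter _) = >pop-constructorTerm (empty-over con-isConstructor)

  predicativeRecursive : PredicativeRecursive S R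
  predicativeRecursive = constructorTRS , safeMapping , precedence , admissible , decreasing
    where
      decreasing : ∀ ρ → ρ ∈ R → lhs ρ >pop rhs ρ
      decreasing ρ ρ∈R with ∈R⇒rule ρ∈R
      ... | κ , refl = rule-decreasing κ

  occ-letter : ∀ x a t → occ S x (letter a t) ≡ occ S x t
  occ-letter x 0F            t = +-identityʳ _
  occ-letter x 1F            t = +-identityʳ _
  occ-letter x 2F            t = +-identityʳ _
  occ-letter x 3F            t = +-identityʳ _
  occ-letter x (auxLetter _) t = +-identityʳ _

  occ-wordOn : ∀ x as t → occ S x (wordOn as t) ≡ occ S x t
  occ-wordOn x []       t = refl
  occ-wordOn x (a ∷ as) t = trans (occ-letter x a _) (occ-wordOn x as t)

  occ-unary : ∀ x m → occ S x (unary m) ≡ 0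
  occ-unary x m = occ-wordOn x (List.replicate m 1F) empty

  occ-rest : ∀ x l t → occ S x (rest l t) ≤ occ S x t
  occ-rest x nothing  t = z≤n
  occ-rest x (just _) t = ≤-refl

  occurrences-variables : ∀ m o x → occs S x (variables m o) ≤ 1 × (x < o → occs S x (variables m o) ≡ 0)
  occurrences-variables zero    o x = z≤n , λ _ → refl
  occurrences-variables (suc m) o x with x ℕ.≟ o | occurrences-variables m (suc o) x
  ... | yes refl | _ , fresh = ≤-reflexive (cong suc (fresh ≤-refl)) , λ x<x → ⊥-elim (<-irrefl refl x<x)
  ... | no  x≢o  | linear , fresh = linear , λ x<o → fresh (m<n⇒m<1+n x<o)

  -- For a term in the variables 0, 1 and 2 the occurrence counts of these three are closed numerals, so their
  -- bounds are decided by computation.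
  linear₀₁₂ : ∀ t {p₀ : True (occ S 0 t ℕ.≤? 1)} {p₁ : True (occ S 1 t ℕ.≤? 1)} {p₂ : True (occ S 2 t ℕ.≤? 1)} →
              (∀ y → occ S (3 + y) t ≡ 0) → ∀ x → occ S x t ≤ 1
  linear₀₁₂ t {p₀}      _     0                   = toWitness p₀
  linear₀₁₂ t {p₁ = p₁} _     1                   = toWitness p₁
  linear₀₁₂ t {p₂ = p₂} _     2                   = toWitness p₂
  linear₀₁₂ t           fresh (suc (suc (suc y))) = subst (_≤ 1) (sym (fresh y)) z≤n

  lhs-linear : ∀ κ x → occ S x (lhs (rule κ)) ≤ 1
  lhs-linear kMain                 x = proj₁ (occurrences-variables n 0 x)
  lhs-linear (kStart nothing)      x = z≤n
  lhs-linear (kStart (just a))     x rewrite occ-letter x a x₀ = linear₀₁₂ (startT x₀) (λ _ → refl) x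
  lhs-linear (kAppend nothing)     x = linear₀₁₂ (appendT empty x₁) (λ _ → refl) x
  lhs-linear (kAppend (just a))    x rewrite occ-letter x a x₀ = linear₀₁₂ (appendT x₀ x₁) (λ _ → refl) x
  lhs-linear (kStep q a l r)       x
    rewrite occ-unary x (toℕ q) | occ-wordOn x (List.fromMaybe l) (rest l x₀)
          | occ-letter x a (wordOn (List.fromMaybe r) (rest r x₁)) | occ-wordOn x (List.fromMaybe r) (rest r x₁)
          | +-identityʳ (occ S x (rest l x₀) + (occ S x (rest r x₁) + 0))
    = ≤-trans (+-mono-≤ (occ-rest x l x₀) (+-monoˡ-≤ 0 (occ-rest x r x₁))) (linear₀₁₂ (config x₀ x₁ empty) (λ _ → refl) x)
  lhs-linear kIterateBase          x = linear₀₁₂ (iterateT 0F x₀ x₁ x₂) (λ _ → refl) x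
  lhs-linear (kIterate j nothing)  x = linear₀₁₂ (iterateT (fsuc j) x₀ empty x₂) (λ _ → refl) x
  lhs-linear (kIterate j (just a)) x rewrite occ-letter x a x₁ = linear₀₁₂ (iterateT (fsuc j) x₀ x₁ x₂) (λ _ → refl) x
  lhs-linear kOutput               x = linear₀₁₂ (outputT (config x₀ x₁ x₂)) (λ _ → refl) x
  lhs-linear (kRead nothing)       x = z≤n
  lhs-linear (kRead (just a))      x rewrite occ-letter x a x₀ = linear₀₁₂ (readT x₀) (λ _ → refl) x

  leftLinear : LeftLinear S R
  leftLinear ρ ρ∈R x with ∈R⇒rule ρ∈R
  ... | κ , refl = lhs-linear κ x

  letterView : Tm → Maybe (Ltr × Tm)
  letterView (app (con cS1) (t ∷ᵥ []ᵥ))                          = just (1F , t)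
  letterView (app (con cS2) (t ∷ᵥ []ᵥ))                          = just (2F , t)
  letterView (app (con (cX 1F)) (t ∷ᵥ []ᵥ))                      = just (0F , t)
  letterView (app (con (cX 2F)) (t ∷ᵥ []ᵥ))                      = just (3F , t)
  letterView (app (con (cX (fsuc (fsuc (fsuc i))))) (t ∷ᵥ []ᵥ)) = just (auxLetter i , t)
  letterView _                                                   = nothing

  letterView-letter : ∀ a t → letterView (letter a t) ≡ just (a , t)
  letterView-letter 0F            t = refl
  letterView-letter 1F            t = refl
  letterView-letter 2F            t = refl
  letterView-letter 3F            t = refl
  letterView-letter (auxLetter _) t = refl

  firstLetter : Tm → Maybe (Maybe Ltr)
  firstLetter (app (con cε) []ᵥ) = just nothing
  firstLetter t                  = Maybe.map (just ∘ proj₁) (letterView t)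

  firstLetter-letter : ∀ a t → firstLetter (letter a t) ≡ just (just a)
  firstLetter-letter 0F            t = refl
  firstLetter-letter 1F            t = refl
  firstLetter-letter 2F            t = refl
  firstLetter-letter 3F            t = refl
  firstLetter-letter (auxLetter _) t = refl

  firstLetter-rest : ∀ l t → firstLetter (wordOn (List.fromMaybe l) (rest l t)) ≡ just l
  firstLetter-rest nothing  t = refl
  firstLetter-rest (just a) t = firstLetter-letter a t

  unaryLength : Tm → ℕ
  unaryLength (app (con cS1) (t ∷ᵥ []ᵥ)) = suc (unaryLength t)
  unaryLength _                          = 0

  unaryLength-unary : ∀ m → unaryLength (unary m) ≡ m
  unaryLength-unary zero    = refl
  unaryLength-unary (suc m) = cong suc (unaryLength-unary m)

  toFin? : (b : ℕ) → ℕ → Maybe (Fin b)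
  toFin? zero    _       = nothing
  toFin? (suc b) zero    = just 0F
  toFin? (suc b) (suc m) = Maybe.map fsuc (toFin? b m)

  toFin?-toℕ : ∀ {b} (q : Fin b) → toFin? b (toℕ q) ≡ just q
  toFin?-toℕ 0F       = refl
  toFin?-toℕ (fsuc q) rewrite toFin?-toℕ q = refl

  stepKey : Tm → Maybe Key
  stepKey (app (con (cX 0F)) (q ∷ᵥ l ∷ᵥ r ∷ᵥ []ᵥ)) = do
    q′       ← toFin? (suc Q) (unaryLength q)
    l′       ← firstLetter l
    (a , r₀) ← letterView r
    r′       ← firstLetter r₀
    just (kStep q′ a l′ r′)
  stepKey _ = nothing

  keyOf : Tm → Maybe Key
  keyOf (app (def mainSym) _)                                = just kMain
  keyOf (app (def startSym) (t ∷ᵥ []ᵥ))                      = Maybe.map (λ h → kStart h) (firstLetter t)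
  keyOf (app (def appendSym) (t ∷ᵥ _ ∷ᵥ []ᵥ))                = Maybe.map (λ h → kAppend h) (firstLetter t)
  keyOf (app (def stepSym) (t ∷ᵥ []ᵥ))                       = stepKey t
  keyOf (app (def outputSym) _)                              = just kOutput
  keyOf (app (def readSym) (t ∷ᵥ []ᵥ))                       = Maybe.map (λ h → kRead h) (firstLetter t)
  keyOf (app (def (iterateSym 0F)) _)                        = just kIterateBase
  keyOf (app (def (iterateSym (fsuc j))) (_ ∷ᵥ z ∷ᵥ _ ∷ᵥ []ᵥ)) = Maybe.map (λ h → kIterate j h) (firstLetter z)
  keyOf _                                                    = nothing

  letter-⟪⟫ : ∀ a t σ → letter a t ⟪ σ ⟫ ≡ letter a (t ⟪ σ ⟫)
  letter-⟪⟫ 0F            t σ = refl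
  letter-⟪⟫ 1F            t σ = refl
  letter-⟪⟫ 2F            t σ = refl
  letter-⟪⟫ 3F            t σ = refl
  letter-⟪⟫ (auxLetter _) t σ = refl

  wordOn-⟪⟫ : ∀ as t σ → wordOn as t ⟪ σ ⟫ ≡ wordOn as (t ⟪ σ ⟫)
  wordOn-⟪⟫ []       t σ = refl
  wordOn-⟪⟫ (a ∷ as) t σ = trans (letter-⟪⟫ a _ σ) (cong (letter a) (wordOn-⟪⟫ as t σ))

  unary-⟪⟫ : ∀ m σ → unary m ⟪ σ ⟫ ≡ unary m
  unary-⟪⟫ m σ = wordOn-⟪⟫ (List.replicate m 1F) empty σ

  rest-⟪⟫ : ∀ l x σ → rest l (var x) ⟪ σ ⟫ ≡ rest l (σ x)
  rest-⟪⟫ nothing  x σ = refl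
  rest-⟪⟫ (just _) x σ = refl

  keyOf-lhs : ∀ κ σ → keyOf (lhs (rule κ) ⟪ σ ⟫) ≡ just κ
  keyOf-lhs kMain                 σ = refl
  keyOf-lhs (kStart nothing)      σ = refl
  keyOf-lhs (kStart (just a))     σ rewrite letter-⟪⟫ a x₀ σ | firstLetter-letter a (σ 0) = refl
  keyOf-lhs (kAppend nothing)     σ = refl
  keyOf-lhs (kAppend (just a))    σ rewrite letter-⟪⟫ a x₀ σ | firstLetter-letter a (σ 0) = refl
  keyOf-lhs (kStep q a l r)       σ
    rewrite unary-⟪⟫ (toℕ q) σ | unaryLength-unary (toℕ q) | toFin?-toℕ q
          | wordOn-⟪⟫ (List.fromMaybe l) (rest l x₀) σ | rest-⟪⟫ l 0 σ | firstLetter-rest l (σ 0)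
          | letter-⟪⟫ a (wordOn (List.fromMaybe r) (rest r x₁)) σ
          | letterView-letter a (wordOn (List.fromMaybe r) (rest r x₁) ⟪ σ ⟫)
          | wordOn-⟪⟫ (List.fromMaybe r) (rest r x₁) σ | rest-⟪⟫ r 1 σ | firstLetter-rest r (σ 1) = refl
  keyOf-lhs kIterateBase          σ = refl
  keyOf-lhs (kIterate j nothing)  σ = refl
  keyOf-lhs (kIterate j (just a)) σ rewrite letter-⟪⟫ a x₁ σ | firstLetter-letter a (σ 1) = refl
  keyOf-lhs kOutput               σ = refl
  keyOf-lhs (kRead nothing)       σ = refl
  keyOf-lhs (kRead (just a))      σ rewrite letter-⟪⟫ a x₀ σ | firstLetter-letter a (σ 0) = refl

  length-R : length R ≡ size
  length-R = length-tabulate (rule ∘ keyAt)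

  index : Fin (length R) → Fin size
  index = Fin.cast length-R

  index-injective : ∀ {i j} → index i ≡ index j → i ≡ j
  index-injective {i} {j} e =
    trans (sym (cast-involutive (sym length-R) length-R i)) (trans (cong (Fin.cast _) e) (cast-involutive (sym length-R) length-R j))

  lookup-R : ∀ i → List.lookup R i ≡ rule (keyAt (index i))
  lookup-R i = trans (cong (List.lookup R) (sym (cast-involutive (sym length-R) length-R i))) (lookup-tabulate (rule ∘ keyAt) (index i))

  lhs-rootsDistinct : ∀ i j σ τ → lhs (List.lookup R i) ⟪ σ ⟫ ≡ lhs (List.lookup R j) ⟪ τ ⟫ → i ≡ j
  lhs-rootsDistinct i j σ τ e = index-injective (Injection.injective (↔⇒↣ enumeration) (just-injective (begin
      just (keyAt (index i))                     ≡⟨ keyOf-lhs (keyAt (index i)) σ ⟨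
      keyOf (lhs (rule (keyAt (index i))) ⟪ σ ⟫) ≡⟨ cong (λ ρ → keyOf (lhs ρ ⟪ σ ⟫)) (lookup-R i) ⟨
      keyOf (lhs (List.lookup R i) ⟪ σ ⟫)        ≡⟨ cong keyOf e ⟩
      keyOf (lhs (List.lookup R j) ⟪ τ ⟫)        ≡⟨ cong (λ ρ → keyOf (lhs ρ ⟪ τ ⟫)) (lookup-R j) ⟩
      keyOf (lhs (rule (keyAt (index j))) ⟪ τ ⟫) ≡⟨ keyOf-lhs (keyAt (index j)) τ ⟩
      just (keyAt (index j))                     ∎)))
    where open ≡-Reasoning

  orthogonal : Orthogonal S R
  orthogonal = leftLinear , Constructor.nonOverlapping R constructorTRS lhs-rootsDistinct

  open Constructor R constructorTRS using (rootStep-valueArgs; value-normal)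

  infix 4 _⟶_ _⟶*_
  _⟶_ _⟶*_ : Tm → Tm → Set
  _⟶_  = _→ᵢ_ S R
  _⟶*_ = _→ᵢ*_ S R

  rule-step : ∀ κ σ {f ts u} → lhs (rule κ) ⟪ σ ⟫ ≡ app f ts → (∀ i → IsValue S (lookup ts i)) →
              rhs (rule κ) ⟪ σ ⟫ ≡ u → app f ts ⟶ u
  rule-step κ = rootStep-valueArgs (rule∈R κ)

  ≡⇒⟶* : ∀ {t u} → t ≡ u → t ⟶* u
  ≡⇒⟶* refl = ε

  word-value : ∀ as → IsValue S (word as)
  word-value as = constructorTerm-value (word-over {P = λ _ → ⊤} con-isConstructor as)

  config-value : ∀ d → IsValue S ⌜ d ⌝ᶜ
  config-value d = constructorTerm-value
    (configOn-over {P = λ _ → ⊤} con-isConstructor d (empty-over con-isConstructor) (empty-over con-isConstructor))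

  steps-under-letter : ∀ a {t t′} → t ⟶* t′ → letter a t ⟶* letter a t′
  steps-under-letter 0F            = steps-in-argument R (_ ∷ᵥ []ᵥ) 0F
  steps-under-letter 1F            = steps-in-argument R (_ ∷ᵥ []ᵥ) 0F
  steps-under-letter 2F            = steps-in-argument R (_ ∷ᵥ []ᵥ) 0F
  steps-under-letter 3F            = steps-in-argument R (_ ∷ᵥ []ᵥ) 0F
  steps-under-letter (auxLetter _) = steps-in-argument R (_ ∷ᵥ []ᵥ) 0F

  wordOn-word : ∀ as bs → wordOn as (word bs) ≡ word (as ++ bs)
  wordOn-word []       bs = refl
  wordOn-word (a ∷ as) bs = cong (letter a) (wordOn-word as bs)

  append-evaluates : ∀ as {t} → IsValue S t → appendT (word as) t ⟶* wordOn as t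
  append-evaluates []       {t} v =
    rule-step (kAppend nothing) (fromVec (t ∷ᵥ t ∷ᵥ []ᵥ)) refl (λ { 0F → conV (λ ()) ; 1F → v }) refl ◅ ε
  append-evaluates (a ∷ as) {t} v =
    rule-step (kAppend (just a)) σ (cong (λ z → appendT z t) (letter-⟪⟫ a x₀ σ)) (λ { 0F → word-value (a ∷ as) ; 1F → v })
              (letter-⟪⟫ a _ σ)
    ◅ steps-under-letter a (append-evaluates as v)
    where σ = fromVec (word as ∷ᵥ t ∷ᵥ []ᵥ)

  word-digits : ∀ ds → word (List.map (digitLetter M) ds) ≡ digitsTerm S ds
  word-digits []        = refl
  word-digits (d1 ∷ ds) = cong (letter 1F) (word-digits ds)
  word-digits (d2 ∷ ds) = cong (letter 2F) (word-digits ds)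

  numeral-value : ∀ m → IsValue S (⌜_⌝ S m)
  numeral-value m = subst (IsValue S) (word-digits (digits m)) (word-value (List.map (digitLetter M) (digits m)))

  σo≡ : ∀ {m x} {xs : Vec ℕ m} o σ → (∀ i → σ (o + toℕ i) ≡ ⌜_⌝ S (lookup (x ∷ᵥ xs) i)) →
        σ o ≡ word (List.map (digitLetter M) (digits x))
  σo≡ {x = x} o σ σ≡ = trans (cong σ (sym (+-identityʳ o))) (trans (σ≡ 0F) (sym (word-digits (digits x))))

  inputTerm-evaluates : ∀ {m} (xs : Vec ℕ m) o σ → (∀ i → σ (o + toℕ i) ≡ ⌜_⌝ S (lookup xs i)) →
                        inputTerm m o ⟪ σ ⟫ ⟶* word (encodeInput M xs)
  inputTerm-evaluates []ᵥ             o σ σ≡ = ε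
  inputTerm-evaluates (x ∷ᵥ []ᵥ)       o σ σ≡ = ≡⇒⟶* (σo≡ o σ σ≡)
  inputTerm-evaluates {suc (suc m)} (x ∷ᵥ xs@(_ ∷ᵥ _)) o σ σ≡ =
    steps-in-argument R (σ o ∷ᵥ letter 3F (inputTerm (suc m) (suc o) ⟪ σ ⟫) ∷ᵥ []ᵥ) 1F
      (steps-under-letter 3F (inputTerm-evaluates xs (suc o) σ (λ i → trans (cong σ (sym (+-suc o (toℕ i)))) (σ≡ (fsuc i)))))
    ◅◅ ≡⇒⟶* (cong (λ z → appendT z (letter 3F (word (encodeInput M xs)))) (σo≡ o σ σ≡))
    ◅◅ append-evaluates (List.map (digitLetter M) (digits x)) (word-value (3F ∷ encodeInput M xs))
    ◅◅ ≡⇒⟶* (wordOn-word (List.map (digitLetter M) (digits x)) (3F ∷ encodeInput M xs))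

  adjacent beyond : List Ltr → List Ltr
  adjacent ls = List.fromMaybe (List.head ls)
  beyond ls   = List.drop 1 ls

  extendTape : List Ltr → List Ltr → Config M → Config M
  extendTape as bs (conf q ls a rs) = conf q (ls ++ as) a (rs ++ bs)

  window : Config M → Config M
  window (conf q ls a rs) = conf q (adjacent ls) a (adjacent rs)

  extendTape-window : ∀ q a ls rs → extendTape (beyond ls) (beyond rs) (window (conf q ls a rs)) ≡ conf q ls a rs
  extendTape-window q a []      []      = refl
  extendTape-window q a []      (_ ∷ _) = refl
  extendTape-window q a (_ ∷ _) []      = refl
  extendTape-window q a (_ ∷ _) (_ ∷ _) = refl

  -- A machine step only inspects the scanned cell and its two neighbours.
  move-local : ∀ q b ls rs m → extendTape (beyond ls) (beyond rs) (move M q (adjacent ls) b (adjacent rs) m) ≡ move M q ls b rs m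
  move-local q b []      []      left  = refl
  move-local q b []      (_ ∷ _) left  = refl
  move-local q b (_ ∷ _) []      left  = refl
  move-local q b (_ ∷ _) (_ ∷ _) left  = refl
  move-local q b []      []      right = refl
  move-local q b []      (_ ∷ _) right = refl
  move-local q b (_ ∷ _) []      right = refl
  move-local q b (_ ∷ _) (_ ∷ _) right = refl
  move-local q b []      []      stay  = refl
  move-local q b []      (_ ∷ _) stay  = refl
  move-local q b (_ ∷ _) []      stay  = refl
  move-local q b (_ ∷ _) (_ ∷ _) stay  = refl

  step-local : ∀ q a ls rs → extendTape (beyond ls) (beyond rs) (stepConfig (window (conf q ls a rs))) ≡ stepConfig (conf q ls a rs)
  step-local q a ls rs with δ q a
  ... | nothing           = extendTape-window q a ls rs
  ... | just (q′ , b , m) = move-local q′ b ls rs m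

  configOn-⟪⟫ : ∀ tl tr d σ → configOn tl tr d ⟪ σ ⟫ ≡ configOn (tl ⟪ σ ⟫) (tr ⟪ σ ⟫) d
  configOn-⟪⟫ tl tr (conf q ls a rs) σ
    rewrite unary-⟪⟫ (toℕ q) σ | wordOn-⟪⟫ ls tl σ | letter-⟪⟫ a (wordOn rs tr) σ | wordOn-⟪⟫ rs tr σ = refl

  configOn-word : ∀ as bs d → configOn (word as) (word bs) d ≡ ⌜ extendTape as bs d ⌝ᶜ
  configOn-word as bs (conf q ls a rs) rewrite wordOn-word ls as | wordOn-word rs bs = refl

  rest-word : ∀ as → rest (List.head as) (word (beyond as)) ≡ word (beyond as)
  rest-word []      = refl
  rest-word (_ ∷ _) = refl

  step-evaluates : ∀ d → stepT ⌜ d ⌝ᶜ ⟶ ⌜ stepConfig d ⌝ᶜ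
  step-evaluates d@(conf q ls a rs) =
    rule-step (kStep q a (List.head ls) (List.head rs)) σ (cong stepT (instance-of (window d) (extendTape-window q a ls rs)))
      (λ { 0F → config-value d }) (instance-of (stepConfig (window d)) (step-local q a ls rs))
    where
      σ = fromVec (word (beyond ls) ∷ᵥ word (beyond rs) ∷ᵥ []ᵥ)
      instance-of : ∀ d′ {d″} → extendTape (beyond ls) (beyond rs) d′ ≡ d″ →
                    configOn (rest (List.head ls) x₀) (rest (List.head rs) x₁) d′ ⟪ σ ⟫ ≡ ⌜ d″ ⌝ᶜ
      instance-of d′ refl = begin
        configOn (rest (List.head ls) x₀) (rest (List.head rs) x₁) d′ ⟪ σ ⟫
          ≡⟨ configOn-⟪⟫ _ _ d′ σ ⟩
        configOn (rest (List.head ls) x₀ ⟪ σ ⟫) (rest (List.head rs) x₁ ⟪ σ ⟫) d′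
          ≡⟨ cong₂ (λ tl tr → configOn tl tr d′) (trans (rest-⟪⟫ (List.head ls) 0 σ) (rest-word ls))
                                                  (trans (rest-⟪⟫ (List.head rs) 1 σ) (rest-word rs)) ⟩
        configOn (word (beyond ls)) (word (beyond rs)) d′
          ≡⟨ configOn-word _ _ d′ ⟩
        ⌜ extendTape (beyond ls) (beyond rs) d′ ⌝ᶜ ∎
        where open ≡-Reasoning

  stepConfig^ : ℕ → Config M → Config M
  stepConfig^ zero    d = d
  stepConfig^ (suc t) d = stepConfig^ t (stepConfig d)

  stepConfig^-+ : ∀ s t d → stepConfig^ (s + t) d ≡ stepConfig^ t (stepConfig^ s d)
  stepConfig^-+ zero    t d = refl
  stepConfig^-+ (suc s) t d = stepConfig^-+ s t (stepConfig d)

  -- Number of steps performed by I_j(x, z, y): I_0 steps once and I_(j+1) runs I_j(x, x, ·) once per letter of z.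
  clockSteps : ℕ → ℕ → ℕ → ℕ
  clockSteps zero    m z       = 1
  clockSteps (suc j) m zero    = 0
  clockSteps (suc j) m (suc z) = clockSteps (suc j) m z + clockSteps j m m

  mutual
    clockSteps-diagonal : ∀ j m → clockSteps j m m ≡ m ^ j
    clockSteps-diagonal zero    m = refl
    clockSteps-diagonal (suc j) m = clockSteps-suc j m m

    clockSteps-suc : ∀ j m z → clockSteps (suc j) m z ≡ z * m ^ j
    clockSteps-suc j m zero = refl
    clockSteps-suc j m (suc z) rewrite clockSteps-suc j m z | clockSteps-diagonal j m = +-comm (z * m ^ j) (m ^ j)

  iterate-evaluates : ∀ jn (j : Fin (2 + k)) → toℕ j ≡ jn → ∀ xs zs d →
    iterateT j (word xs) (word zs) ⌜ d ⌝ᶜ ⟶* ⌜ stepConfig^ (clockSteps jn (length xs) (length zs)) d ⌝ᶜ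
  iterate-evaluates zero 0F _ xs zs d =
    rule-step kIterateBase (fromVec (word xs ∷ᵥ word zs ∷ᵥ ⌜ d ⌝ᶜ ∷ᵥ []ᵥ)) refl
      (λ { 0F → word-value xs ; 1F → word-value zs ; 2F → config-value d }) refl
    ◅ step-evaluates d ◅ ε
  iterate-evaluates (suc jn) (fsuc j) _ xs [] d =
    rule-step (kIterate j nothing) (fromVec (word xs ∷ᵥ empty ∷ᵥ ⌜ d ⌝ᶜ ∷ᵥ []ᵥ)) refl
      (λ { 0F → word-value xs ; 1F → word-value [] ; 2F → config-value d }) refl
    ◅ ε
  iterate-evaluates (suc jn) (fsuc j) j≡ xs (a ∷ zs) d =
    rule-step (kIterate j (just a)) σ (cong (λ z → iterateT (fsuc j) (word xs) z ⌜ d ⌝ᶜ) (letter-⟪⟫ a x₁ σ))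
      (λ { 0F → word-value xs ; 1F → word-value (a ∷ zs) ; 2F → config-value d }) refl
    ◅ steps-in-argument R (word xs ∷ᵥ word xs ∷ᵥ iterateT (fsuc j) (word xs) (word zs) ⌜ d ⌝ᶜ ∷ᵥ []ᵥ) 2F
        (iterate-evaluates (suc jn) (fsuc j) j≡ xs zs d)
    ◅◅ iterate-evaluates jn (inject₁ j) (trans (toℕ-inject₁ j) (suc-injective j≡)) xs xs _
    ◅◅ ≡⇒⟶* (cong ⌜_⌝ᶜ (sym (stepConfig^-+ (clockSteps (suc jn) (length xs) (length zs)) (clockSteps jn (length xs) (length xs)) d)))
    where σ = fromVec (word xs ∷ᵥ word zs ∷ᵥ ⌜ d ⌝ᶜ ∷ᵥ []ᵥ)

  start-evaluates : ∀ w → startT (word w) ⟶ clocked (word w) ⌜ initial M w ⌝ᶜ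
  start-evaluates [] = rule-step (kStart nothing) (fromVec []ᵥ) refl (λ { 0F → word-value [] })
    (cong (λ z → outputT (iterateT topLevel (letter 1F empty) z ⌜ initial M [] ⌝ᶜ)) (unary-⟪⟫ (c + c) _))
  start-evaluates (a ∷ w) = rule-step (kStart (just a)) σ (cong startT (letter-⟪⟫ a x₀ σ)) (λ { 0F → word-value (a ∷ w) }) rhs≡
    where
      σ = fromVec (word w ∷ᵥ []ᵥ)
      rhs≡ : rhs (rule (kStart (just a))) ⟪ σ ⟫ ≡ clocked (word (a ∷ w)) (config (unary 0) empty (word (a ∷ w)))
      rhs≡ rewrite letter-⟪⟫ a x₀ σ | unary-⟪⟫ (c + c) σ = refl

  read-evaluates : ∀ as → readT (word as) ⟶* digitsTerm S (readDigits M as)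
  read-evaluates [] = rule-step (kRead nothing) (fromVec []ᵥ) refl (λ { 0F → word-value [] }) refl ◅ ε
  read-evaluates (a ∷ as) = rule-step (kRead (just a)) σ (cong readT (letter-⟪⟫ a x₀ σ)) (λ { 0F → word-value (a ∷ as) }) refl
                          ◅ readLetter-evaluates a
    where
      σ = fromVec (word as ∷ᵥ []ᵥ)
      readLetter-evaluates : ∀ a → readLetter a ⟪ σ ⟫ ⟶* digitsTerm S (readDigits M (a ∷ as))
      readLetter-evaluates 0F            = ε
      readLetter-evaluates 1F            = steps-under-letter 1F (read-evaluates as)
      readLetter-evaluates 2F            = steps-under-letter 2F (read-evaluates as)
      readLetter-evaluates 3F            = ε
      readLetter-evaluates (auxLetter _) = ε

  output-evaluates : ∀ h → outputT ⌜ h ⌝ᶜ ⟶* ⌜_⌝ S (output M h)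
  output-evaluates (conf q ls a rs) =
    rule-step kOutput (fromVec (unary (toℕ q) ∷ᵥ word ls ∷ᵥ word (a ∷ rs) ∷ᵥ []ᵥ)) refl
      (λ { 0F → config-value (conf q ls a rs) }) refl
    ◅ read-evaluates (a ∷ rs)
    ◅◅ ≡⇒⟶* (cong (digitsTerm S) (sym (digits-digitsValue _)))

  runFor-stepConfig^ : ∀ t d h → runFor M t d ≡ just h → ∀ N → t ≤ N → stepConfig^ N d ≡ h
  runFor-stepConfig^ t d h e N t≤N with next M d in eq
  runFor-stepConfig^ t       d .d refl N t≤N | nothing = halted N
    where
      halted : ∀ N → stepConfig^ N d ≡ d
      halted zero    = refl
      halted (suc N) = trans (cong (λ d′ → stepConfig^ N (Maybe.fromMaybe d d′)) eq) (halted N)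
  runFor-stepConfig^ (suc t) d h e (suc N) (s≤s t≤N) | just d′ =
    trans (cong (λ d″ → stepConfig^ N (Maybe.fromMaybe d d″)) eq) (runFor-stepConfig^ t d′ h e N t≤N)

  time≤clock : ∀ m → c * suc m ^ k + c ≤ clockSteps (toℕ topLevel) (suc m) (length (List.replicate {A = Ltr} (c + c) 1F))
  time≤clock m = subst₂ (λ j z → c * suc m ^ k + c ≤ clockSteps j (suc m) z)
    (sym (toℕ-fromℕ (suc k))) (sym (length-replicate (c + c))) bound
    where
      bound : c * suc m ^ k + c ≤ clockSteps (suc k) (suc m) (c + c)
      bound rewrite clockSteps-suc k (suc m) (c + c) | *-distribʳ-+ (suc m ^ k) c c =
        +-monoʳ-≤ (c * suc m ^ k) (m≤m*n c (suc m ^ k) {{m^n≢0 (suc m) k}})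

  substs-variables : ∀ {m} o (ts : Vec Tm m) σ → (∀ i → σ (o + toℕ i) ≡ lookup ts i) → substs S (variables m o) σ ≡ ts
  substs-variables o []ᵥ        σ σ≡ = refl
  substs-variables o (t ∷ᵥ ts) σ σ≡ =
    cong₂ _∷ᵥ_ (trans (cong σ (sym (+-identityʳ o))) (σ≡ 0F))
               (substs-variables (suc o) ts σ (λ i → trans (cong σ (sym (+-suc o (toℕ i)))) (σ≡ (fsuc i))))

  main-evaluates : ∀ f → ComputesInTime M f (λ m → c * suc m ^ k + c) → ∀ xs → mainT (Vec.map (⌜_⌝ S) xs) ⟶* ⌜_⌝ S (f xs)
  main-evaluates f computesInTime xs with computesInTime xs
  ... | h , halts , output≡ =
    rule-step kMain σ (cong mainT (substs-variables 0 inputs σ (fromVec-lookup inputs))) inputs-value refl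
    ◅ steps-in-argument R (_ ∷ᵥ []ᵥ) 0F
        (inputTerm-evaluates xs 0 σ (λ i → trans (fromVec-lookup inputs i) (lookup-map i (⌜_⌝ S) xs)))
    ◅◅ start-evaluates w
    ◅ steps-in-argument R (_ ∷ᵥ []ᵥ) 0F
        (iterate-evaluates (toℕ topLevel) topLevel refl (1F ∷ w) (List.replicate (c + c) 1F) (initial M w))
    ◅◅ ≡⇒⟶* (cong (outputT ∘ ⌜_⌝ᶜ) (runFor-stepConfig^ _ _ h halts _ (time≤clock (length w))))
    ◅◅ output-evaluates h
    ◅◅ ≡⇒⟶* (cong (⌜_⌝ S) output≡)
    where
      inputs = Vec.map (⌜_⌝ S) xs
      σ = fromVec inputs
      w = encodeInput M xs
      inputs-value : ∀ i → IsValue S (lookup inputs i)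
      inputs-value i = subst (IsValue S) (sym (lookup-map i (⌜_⌝ S) xs)) (numeral-value (lookup xs i))

  computes : ∀ f → ComputesInTime M f (λ m → c * suc m ^ k + c) → Computes S R f
  computes f computesInTime = mainSym , refl , λ xs w →
      (λ (steps , normal , _) → normalForm-unique steps normal (main-evaluates f computesInTime xs) (value-normal (numeral-value (f xs))))
    , (λ { refl → main-evaluates f computesInTime xs , value-normal (numeral-value (f xs)) , numeral-value (f xs) })
    where open Confluence R constructorTRS orthogonal using (normalForm-unique)


theorem7p4 : ∀ {n} (f : Vec ℕ n → ℕ) → PolyTimeComputable f →
    Σ Sig λ S → Σ (TRS S) λ R →
      Orthogonal S R × PredicativeRecursive S R × Computes S R f
theorem7p4 {n} f (M , c , k , computesInTime) =
  S , R , orthogonal , predicativeRecursive , computes f computesInTime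
  where open Simulation n M c k
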